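{- (i) For integers $\nu\geq1$ and $0\le j\le 2\nu$, \[\sum_{\mu=0}^\nu\frac{(-1)^\mu}{\mu-j+\frac12}\cdot\frac{(4\nu-2\mu-1)!}{(2(\nu-\mu))!\,(2\nu-\mu-1)!\,\mu!}=2^{4\nu}(-1)^j\frac{(2\nu-j)!\,j!}{(2j)!\,(2(\nu-j)+1)!},\] with the convention $1/m!=0$ for negative integers $m$. (ii) For all $\nu\in\mathbb{N}_0$, $\kappa\left(\tfrac32,\tfrac12,\nu\right)=2^{1-2\nu}\sqrt{\pi}\binom{2\nu}{\nu}$, where \[\kappa(k,\ell,\nu)=\frac{1}{(k+\ell+2\nu-2)!\,(k-1)}\sum_{\mu=0}^\nu\frac{\Gamma(2-k)\Gamma(\ell+2\nu-\mu)}{\Gamma(2-k-\mu)}\binom{k+\nu-1}{\nu-\mu}\binom{\ell+\nu-1}{\mu}.\]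
   Context: Binomial coefficients with non-integer upper entry are generalized: $\binom{x}{j}=x(x-1)\cdots(x-j+1)/j!$. The multinomial coefficient in (i) is written out as $\frac{(4\nu-2\mu-1)!}{(2(\nu-\mu))!(2\nu-\mu-1)!\mu!}$ (the paper's notation $\binom{4\nu-2\mu-1}{2(\nu-\mu),2\nu-\mu-1}$). -}

module Defs where

open import Data.Nat as ℕ using (ℕ; zero; suc; _!; _∸_)
open import Data.Nat.Properties using (_!≢0)
open import Data.Integer as ℤ using (ℤ; +_; -[1+_])
open import Data.Rational as ℚ using (ℚ; _/_; _+_; _*_; -_; 0ℚ; 1ℚ)

ℕtoℚ : ℕ → ℚ
ℕtoℚ n = (+ n) / 1

ℤtoℚ : ℤ → ℚ
ℤtoℚ m = m / 1

sgn : ℕ → ℚ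
sgn zero    = 1ℚ
sgn (suc j) = - sgn j

invFactℕ : ℕ → ℚ
invFactℕ n = (+ 1) / (n !) where instance _ = n !≢0

invFact : ℤ → ℚ
invFact (+ n)    = invFactℕ n
invFact -[1+ n ] = 0ℚ

factQ : ℕ → ℚ
factQ n = ℕtoℚ (n !)

half : ℤ → ℚ
half m = (ℤ.+ 1 ℤ.+ (ℤ.+ 2 ℤ.* m)) / 2

-- 1 / (m + 1/2) = 2 / (2m+1), for m : ℤ (never a division by zero)
halfInv : ℤ → ℚ
halfInv (+ n)    = (+ 2) / (suc (2 ℕ.* n))
halfInv -[1+ n ] = -[1+ 1 ] / (suc (2 ℕ.* n))

sumTo : ℕ → (ℕ → ℚ) → ℚ
sumTo zero    f = f 0
sumTo (suc n) f = sumTo n f + f (suc n)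

fallingQ : ℚ → ℕ → ℚ
fallingQ x zero    = 1ℚ
fallingQ x (suc j) = fallingQ x j * (x ℚ.- ℕtoℚ j)

binomQ : ℚ → ℕ → ℚ
binomQ x j = fallingQ x j * invFactℕ j

-- Every value Γ(m + 1/2), m ∈ ℤ, is a rational multiple of √π; it is
-- determined by Γ(1/2) = √π and the functional equation Γ(x+1) = x Γ(x).
-- Γhalf m  is the rational number with  Γ(m + 1/2) = Γhalf m · √π,
-- Γhalfinv m  is the rational number with 1/Γ(m + 1/2) = Γhalfinv m / √π.

Γhalf : ℤ → ℚ
Γhalf (+ zero)      = 1ℚ
Γhalf (+ suc n)     = half (+ n) * Γhalf (+ n)            -- Γ(x+1) = x Γ(x)
Γhalf -[1+ zero ]   = halfInv -[1+ zero ] * Γhalf (+ 0)   -- Γ(x) = Γ(x+1)/x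
Γhalf -[1+ suc n ]  = halfInv -[1+ suc n ] * Γhalf -[1+ n ]

Γhalfinv : ℤ → ℚ
Γhalfinv (+ zero)     = 1ℚ
Γhalfinv (+ suc n)    = halfInv (+ n) * Γhalfinv (+ n)
Γhalfinv -[1+ zero ]  = half -[1+ zero ] * Γhalfinv (+ 0)
Γhalfinv -[1+ suc n ] = half -[1+ suc n ] * Γhalfinv -[1+ n ]

-- κ(k, ℓ, ν) for half-integer k = a + 1/2, ℓ = b + 1/2  (a b : ℤ):
--   κ(k,ℓ,ν) = 1/((k+ℓ+2ν-2)! (k-1)) Σ_{μ=0}^{ν} Γ(2-k) Γ(ℓ+2ν-μ) / Γ(2-k-μ)
--                 · binom(k+ν-1, ν-μ) · binom(ℓ+ν-1, μ)
-- Here k+ℓ+2ν-2 = a+b+2ν-1,  k-1 = (a-1)+1/2,  2-k = (1-a)+1/2,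
-- ℓ+2ν-μ = (b+2ν-μ)+1/2,  k+ν-1 = (a+ν-1)+1/2,  ℓ+ν-1 = (b+ν-1)+1/2.
-- Each summand is √π·√π/√π = √π times a rational, so κ(k,ℓ,ν) = κcoef a b ν · √π.

κcoef : ℤ → ℤ → ℕ → ℚ
κcoef a b ν =
  invFact (a ℤ.+ b ℤ.+ (+ (2 ℕ.* ν)) ℤ.- ℤ.+ 1) * halfInv (a ℤ.- ℤ.+ 1) *
  sumTo ν (λ μ →
    Γhalf (ℤ.+ 1 ℤ.- a) * Γhalf (b ℤ.+ (+ (2 ℕ.* ν)) ℤ.- (+ μ))
      * Γhalfinv (ℤ.+ 1 ℤ.- a ℤ.- (+ μ))
      * binomQ (half (a ℤ.+ (+ ν) ℤ.- ℤ.+ 1)) (ν ∸ μ)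
      * binomQ (half (b ℤ.+ (+ ν) ℤ.- ℤ.+ 1)) μ)

twoPow1m2 : ℕ → ℚ
twoPow1m2 zero    = (+ 2) / 1
twoPow1m2 (suc ν) = twoPow1m2 ν * ((+ 1) / 4)

-- Write S ν j for the sum on the left of (i) and R ν j for the right-hand side.  Both satisfy
-- the recurrence α·X (j + 1) + β·X j = 0 in j, with α = (2ν − j)(2j + 1) and β = (2ν − 2j + 1)(ν − j):
-- for R this is a direct computation with factorials, and for S the recurrence, applied to each
-- summand, telescopes in μ (a Zeilberger certificate).  Since α ≠ 0 for j < 2ν, (i) reduces to
-- j = 0, i.e. to (2ν + 1)·S ν 0 = 2^(4ν).  That in turn follows by induction on ν from a second
-- telescoping certificate, for the recurrence (ν+1)(2ν+1)(2ν+3)·S (ν+1) 0 = 16(ν+1)(2ν+1)²·S ν 0.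
-- For (ii), Γ(m + 1/2) = (2m)! √π / (m! 4^m) and the reflection formula show that the μ-th summand
-- of κ(3/2, 1/2, ν) is 2·4^(−ν)·Γ(ν + 3/2)·Γ(ν + 1/2)/π times the μ-th summand of S ν 0, so κ is
-- evaluated by the j = 0 case of (i).
-- Throughout, every coefficient that occurs is written as a polynomial times one common product
-- of factorials, which turns each identity between them into a polynomial identity.

module Submission where

open import Defs
open import Data.Nat as ℕ using (ℕ; _!; _∸_; _≤_; _^_)
open import Data.Integer as ℤ using (ℤ; +_)
open import Data.Nat.Combinatorics using (_C_; nCk≡n!/k![n-k]!; k![n∸k]!∣n!)
open import Data.Nat.DivMod using (m/n*n≡m)
open import Data.Product using (_×_)
open import Relation.Binary.PropositionalEquality using (_≡_)
open import Data.Rational as ℚ using (ℚ; _+_; _*_)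

open import Agda.Builtin.FromNat using (Number; fromNat)
open import Data.Integer using (-[1+_])
import Data.Integer.Properties as ℤ
open import Data.List using (_∷_; [])
open import Data.Maybe using (Maybe; just; nothing)
open import Data.Nat using (zero; suc; _<_; z≤n; NonZero)
import Data.Nat.Literals as ℕ
import Data.Nat.Properties as ℕ
import Data.Nat.Tactic.RingSolver as ℕ-Solver
import Data.Integer.Tactic.RingSolver as ℤ-Solver
open import Data.Product using (_,_)
open import Data.Rational using (_/_; -_; _-_; 0ℚ; ½)
import Data.Rational.Literals as ℚ
open import Data.Rational.Properties using (+-*-commutativeRing; _≟_; toℚᵘ-injective; toℚᵘ-fromℚᵘ)
import Data.Rational.Properties as ℚ
import Data.Rational.Unnormalised as ℚᵘ
import Data.Rational.Unnormalised.Properties as ℚᵘ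

open import Data.Unit.Base using (tt)
open import Level using (0ℓ)
open import Relation.Binary.PropositionalEquality using (refl; sym; trans; cong; cong₂; subst; module ≡-Reasoning)
open import Relation.Nullary using (yes; no)
open import Relation.Binary.Definitions using (tri<; tri≈; tri>)
open import Tactic.RingSolver using (solve-∀)
open import Tactic.RingSolver.Core.AlmostCommutativeRing using (AlmostCommutativeRing; fromCommutativeRing)

instance
  ℕ-number : Number ℕ
  ℕ-number = ℕ.number

  ℚ-number : Number ℚ
  ℚ-number = ℚ.number

ℚ-ring : AlmostCommutativeRing 0ℓ 0ℓ
ℚ-ring = fromCommutativeRing +-*-commutativeRing isZero
  where
  isZero : (x : ℚ) → Maybe (0ℚ ≡ x)
  isZero x with 0ℚ ≟ x
  ... | yes 0≡x = just 0≡x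
  ... | no _    = nothing

cong₃ : ∀ {A B C D : Set} (f : A → B → C → D) {x x′ y y′ z z′} →
        x ≡ x′ → y ≡ y′ → z ≡ z′ → f x y z ≡ f x′ y′ z′
cong₃ f refl refl refl = refl

cong₄ : ∀ {A B C D E : Set} (f : A → B → C → D → E) {x x′ y y′ z z′ w w′} →
        x ≡ x′ → y ≡ y′ → z ≡ z′ → w ≡ w′ → f x y z w ≡ f x′ y′ z′ w′
cong₄ f refl refl refl refl = refl

ℤtoℚ-≃ : ∀ x → ℚ.toℚᵘ (ℤtoℚ x) ℚᵘ.≃ ℚᵘ.mkℚᵘ x 0
ℤtoℚ-≃ x = toℚᵘ-fromℚᵘ (ℚᵘ.mkℚᵘ x 0)

ℤtoℚ-homo-+ : ∀ x y → ℤtoℚ (x ℤ.+ y) ≡ ℤtoℚ x + ℤtoℚ y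
ℤtoℚ-homo-+ x y = toℚᵘ-injective (begin-equality
  ℚ.toℚᵘ (ℤtoℚ (x ℤ.+ y))                   ≃⟨ ℤtoℚ-≃ (x ℤ.+ y) ⟩
  ℚᵘ.mkℚᵘ (x ℤ.+ y) 0                       ≃⟨ ℚᵘ.*≡* (cong (ℤ._* + 1) (sym (cong₂ ℤ._+_ (ℤ.*-identityʳ x) (ℤ.*-identityʳ y)))) ⟩
  ℚᵘ.mkℚᵘ x 0 ℚᵘ.+ ℚᵘ.mkℚᵘ y 0              ≃⟨ ℚᵘ.+-cong (ℤtoℚ-≃ x) (ℤtoℚ-≃ y) ⟨
  ℚ.toℚᵘ (ℤtoℚ x) ℚᵘ.+ ℚ.toℚᵘ (ℤtoℚ y)      ≃⟨ ℚ.toℚᵘ-homo-+ (ℤtoℚ x) (ℤtoℚ y) ⟨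
  ℚ.toℚᵘ (ℤtoℚ x + ℤtoℚ y)                  ∎)
  where open ℚᵘ.≤-Reasoning

ℤtoℚ-homo-* : ∀ x y → ℤtoℚ (x ℤ.* y) ≡ ℤtoℚ x * ℤtoℚ y
ℤtoℚ-homo-* x y = toℚᵘ-injective (begin-equality
  ℚ.toℚᵘ (ℤtoℚ (x ℤ.* y))                   ≃⟨ ℤtoℚ-≃ (x ℤ.* y) ⟩
  ℚᵘ.mkℚᵘ x 0 ℚᵘ.* ℚᵘ.mkℚᵘ y 0              ≃⟨ ℚᵘ.*-cong (ℤtoℚ-≃ x) (ℤtoℚ-≃ y) ⟨
  ℚ.toℚᵘ (ℤtoℚ x) ℚᵘ.* ℚ.toℚᵘ (ℤtoℚ y)      ≃⟨ ℚ.toℚᵘ-homo-* (ℤtoℚ x) (ℤtoℚ y) ⟨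
  ℚ.toℚᵘ (ℤtoℚ x * ℤtoℚ y)                  ∎)
  where open ℚᵘ.≤-Reasoning

ℤtoℚ-homo‿- : ∀ x → ℤtoℚ (ℤ.- x) ≡ - ℤtoℚ x
ℤtoℚ-homo‿- x = toℚᵘ-injective (begin-equality
  ℚ.toℚᵘ (ℤtoℚ (ℤ.- x))    ≃⟨ ℤtoℚ-≃ (ℤ.- x) ⟩
  ℚᵘ.mkℚᵘ (ℤ.- x) 0        ≃⟨ ℚᵘ.-‿cong (ℤtoℚ-≃ x) ⟨
  ℚᵘ.- ℚ.toℚᵘ (ℤtoℚ x)     ≃⟨ ℚ.toℚᵘ-homo‿- (ℤtoℚ x) ⟨
  ℚ.toℚᵘ (- ℤtoℚ x)        ∎)
  where open ℚᵘ.≤-Reasoning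

/-*-cancel : ∀ i d .{{_ : NonZero d}} → (i / d) * ℕtoℚ d ≡ ℤtoℚ i
/-*-cancel i (suc d) = toℚᵘ-injective (begin-equality
  ℚ.toℚᵘ ((i / suc d) * ℕtoℚ (suc d))              ≃⟨ ℚ.toℚᵘ-homo-* (i / suc d) (ℕtoℚ (suc d)) ⟩
  ℚ.toℚᵘ (i / suc d) ℚᵘ.* ℚ.toℚᵘ (ℕtoℚ (suc d))     ≃⟨ ℚᵘ.*-cong (toℚᵘ-fromℚᵘ (ℚᵘ.mkℚᵘ i d)) (ℤtoℚ-≃ (+ suc d)) ⟩
  ℚᵘ.mkℚᵘ i d ℚᵘ.* ℚᵘ.mkℚᵘ (+ suc d) 0               ≃⟨ ℚᵘ.*≡* (trans (ℤ.*-identityʳ _) (cong (λ t → i ℤ.* + t) (sym (ℕ.*-identityʳ (suc d))))) ⟩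
  ℚᵘ.mkℚᵘ i 0                                        ≃⟨ ℤtoℚ-≃ i ⟨
  ℚ.toℚᵘ (ℤtoℚ i)                                    ∎)
  where open ℚᵘ.≤-Reasoning

ℕtoℚ-homo-+ : ∀ m n → ℕtoℚ (m ℕ.+ n) ≡ ℕtoℚ m + ℕtoℚ n
ℕtoℚ-homo-+ m n = ℤtoℚ-homo-+ (+ m) (+ n)

ℕtoℚ-homo-* : ∀ m n → ℕtoℚ (m ℕ.* n) ≡ ℕtoℚ m * ℕtoℚ n
ℕtoℚ-homo-* m n = trans (cong ℤtoℚ (ℤ.pos-* m n)) (ℤtoℚ-homo-* (+ m) (+ n))

infixl 6 _:+_
infixl 7 _:*_

data ℕExpr : Set where
  `_        : ℕ → ℕExpr
  _:+_ _:*_ : ℕExpr → ℕExpr → ℕExpr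

⟦_⟧ℕ : ℕExpr → ℕ
⟦ ` n ⟧ℕ    = n
⟦ e :+ f ⟧ℕ = ⟦ e ⟧ℕ ℕ.+ ⟦ f ⟧ℕ
⟦ e :* f ⟧ℕ = ⟦ e ⟧ℕ ℕ.* ⟦ f ⟧ℕ

⟦_⟧ℚ : ℕExpr → ℚ
⟦ ` n ⟧ℚ    = ℕtoℚ n
⟦ e :+ f ⟧ℚ = ⟦ e ⟧ℚ + ⟦ f ⟧ℚ
⟦ e :* f ⟧ℚ = ⟦ e ⟧ℚ * ⟦ f ⟧ℚ

ℕtoℚ-⟦⟧ : ∀ e → ℕtoℚ ⟦ e ⟧ℕ ≡ ⟦ e ⟧ℚ
ℕtoℚ-⟦⟧ (` n)    = refl
ℕtoℚ-⟦⟧ (e :+ f) = trans (ℕtoℚ-homo-+ ⟦ e ⟧ℕ ⟦ f ⟧ℕ) (cong₂ _+_ (ℕtoℚ-⟦⟧ e) (ℕtoℚ-⟦⟧ f))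
ℕtoℚ-⟦⟧ (e :* f) = trans (ℕtoℚ-homo-* ⟦ e ⟧ℕ ⟦ f ⟧ℕ) (cong₂ _*_ (ℕtoℚ-⟦⟧ e) (ℕtoℚ-⟦⟧ f))

ℕtoℚ-∸ : ∀ {m n} → n ≤ m → ℕtoℚ (m ∸ n) ≡ ℕtoℚ m - ℕtoℚ n
ℕtoℚ-∸ {m} {n} n≤m = begin
  ℕtoℚ (m ∸ n)                      ≡⟨ +-∸-cancel (ℕtoℚ (m ∸ n)) (ℕtoℚ n) ⟩
  ℕtoℚ (m ∸ n) + ℕtoℚ n - ℕtoℚ n    ≡⟨ cong (_- ℕtoℚ n) (sym (ℕtoℚ-homo-+ (m ∸ n) n)) ⟩
  ℕtoℚ (m ∸ n ℕ.+ n) - ℕtoℚ n       ≡⟨ cong (λ k → ℕtoℚ k - ℕtoℚ n) (ℕ.m∸n+n≡m n≤m) ⟩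
  ℕtoℚ m - ℕtoℚ n                   ∎
  where
  open ≡-Reasoning
  +-∸-cancel : ∀ x y → x ≡ x + y - y
  +-∸-cancel = solve-∀ ℚ-ring

ℤtoℚ-∸ : ∀ m n → ℤtoℚ (+ m ℤ.- + n) ≡ ℕtoℚ m - ℕtoℚ n
ℤtoℚ-∸ m n = trans (ℤtoℚ-homo-+ (+ m) (ℤ.- + n)) (cong (λ x → ℕtoℚ m + x) (ℤtoℚ-homo‿- (+ n)))

*-cancelˡ-ℕtoℚ : ∀ m .{{_ : NonZero m}} {x y} → ℕtoℚ m * x ≡ ℕtoℚ m * y → x ≡ y
*-cancelˡ-ℕtoℚ m {x} {y} eq = begin
  x                              ≡⟨ insert-unit x ⟩
  (+ 1 / m * ℕtoℚ m) * x         ≡⟨ ℚ.*-assoc (+ 1 / m) (ℕtoℚ m) x ⟩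
  + 1 / m * (ℕtoℚ m * x)         ≡⟨ cong (+ 1 / m *_) eq ⟩
  + 1 / m * (ℕtoℚ m * y)         ≡⟨ ℚ.*-assoc (+ 1 / m) (ℕtoℚ m) y ⟨
  (+ 1 / m * ℕtoℚ m) * y         ≡⟨ insert-unit y ⟨
  y                              ∎
  where
  open ≡-Reasoning
  insert-unit : ∀ z → z ≡ (+ 1 / m * ℕtoℚ m) * z
  insert-unit z = trans (sym (ℚ.*-identityˡ z)) (cong (_* z) (sym (/-*-cancel (+ 1) m)))

m≡n+o⇒m∸o≡n : ∀ {a} b c → a ≡ b ℕ.+ c → a ∸ c ≡ b
m≡n+o⇒m∸o≡n b c refl = ℕ.m+n∸n≡m b c

<-by-offset : ∀ (P : ℕ → ℕ → Set) → (∀ m k → P m (suc (m ℕ.+ k))) → ∀ {m n} → m < n → P m n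
<-by-offset P P-offset {m} {n} m<n = subst (P m) (ℕ.m+[n∸m]≡n m<n) (P-offset m (n ∸ suc m))

-- Opaque, so that checking conversion of rational expressions never unfolds n!.
opaque
  fact : ℕ → ℚ
  fact = factQ

  fact⁻¹ : ℕ → ℚ
  fact⁻¹ = invFactℕ

opaque
  unfolding fact fact⁻¹

  fact≡factQ : ∀ n → fact n ≡ factQ n
  fact≡factQ n = refl

  fact⁻¹≡invFactℕ : ∀ n → fact⁻¹ n ≡ invFactℕ n
  fact⁻¹≡invFactℕ n = refl

  fact-suc : ∀ n → fact (suc n) ≡ (1 + ℕtoℚ n) * fact n
  fact-suc n = trans (ℕtoℚ-homo-* (suc n) (n !)) (cong (_* factQ n) (ℕtoℚ-homo-+ 1 n))

  fact*fact⁻¹ : ∀ n → fact n * fact⁻¹ n ≡ 1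
  fact*fact⁻¹ n = trans (ℚ.*-comm (factQ n) (invFactℕ n)) (/-*-cancel (+ 1) (n !) {{n ℕ.!≢0}})

  fact-0 : fact 0 ≡ 1
  fact-0 = refl

  fact⁻¹-0 : fact⁻¹ 0 ≡ 1
  fact⁻¹-0 = refl

fact⁻¹-peel : ∀ {b c} p → fact c ≡ p * fact b → fact⁻¹ b ≡ p * fact⁻¹ c
fact⁻¹-peel {b} {c} p Fc≡pFb = begin
  fact⁻¹ b                                 ≡⟨ sym (ℚ.*-identityʳ (fact⁻¹ b)) ⟩
  fact⁻¹ b * 1                             ≡⟨ cong (fact⁻¹ b *_) (sym (fact*fact⁻¹ c)) ⟩
  fact⁻¹ b * (fact c * fact⁻¹ c)           ≡⟨ cong (λ x → fact⁻¹ b * (x * fact⁻¹ c)) Fc≡pFb ⟩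
  fact⁻¹ b * (p * fact b * fact⁻¹ c)       ≡⟨ regroup (fact⁻¹ b) (fact b) p (fact⁻¹ c) ⟩
  (fact b * fact⁻¹ b) * (p * fact⁻¹ c)     ≡⟨ cong (_* (p * fact⁻¹ c)) (fact*fact⁻¹ b) ⟩
  1 * (p * fact⁻¹ c)                       ≡⟨ ℚ.*-identityˡ _ ⟩
  p * fact⁻¹ c                             ∎
  where
  open ≡-Reasoning
  regroup : ∀ i f p j → i * (p * f * j) ≡ (f * i) * (p * j)
  regroup = solve-∀ ℚ-ring

fact⁻¹-suc : ∀ n → fact⁻¹ n ≡ (1 + ℕtoℚ n) * fact⁻¹ (suc n)
fact⁻¹-suc n = fact⁻¹-peel (1 + ℕtoℚ n) (fact-suc n)

-- rise i x = (x + 1)⋯(x + i); the case i = 1 is separate so that rise unfolds to exactly the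
-- products spelled out in the ring-solver lemmas below.
rise : ℕ → ℚ → ℚ
rise zero          x = 1
rise (suc zero)    x = x + 1
rise (suc (suc i)) x = rise (suc i) x * (x + ℕtoℚ (suc (suc i)))

fact-shift : ∀ i a → fact (i ℕ.+ a) ≡ rise i (ℕtoℚ a) * fact a
fact-shift zero          a = sym (ℚ.*-identityˡ (fact a))
fact-shift (suc zero)    a = trans (fact-suc a) (cong (_* fact a) (ℚ.+-comm 1 (ℕtoℚ a)))
fact-shift (suc (suc i)) a = begin
  fact (suc (suc i ℕ.+ a))                                     ≡⟨ fact-suc (suc i ℕ.+ a) ⟩
  (1 + ℕtoℚ (suc i ℕ.+ a)) * fact (suc i ℕ.+ a)                ≡⟨ cong₂ (λ x y → (1 + x) * y) (ℕtoℚ-homo-+ (suc i) a) (fact-shift (suc i) a) ⟩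
  (1 + (ℕtoℚ (suc i) + ℕtoℚ a)) * (rise (suc i) (ℕtoℚ a) * fact a)
    ≡⟨ regroup (ℕtoℚ (suc i)) (ℕtoℚ a) (rise (suc i) (ℕtoℚ a)) (fact a) ⟩
  rise (suc i) (ℕtoℚ a) * (ℕtoℚ a + (1 + ℕtoℚ (suc i))) * fact a
    ≡⟨ cong (λ x → rise (suc i) (ℕtoℚ a) * (ℕtoℚ a + x) * fact a) (sym (ℕtoℚ-homo-+ 1 (suc i))) ⟩
  rise (suc (suc i)) (ℕtoℚ a) * fact a                         ∎
  where
  open ≡-Reasoning
  regroup : ∀ c x r f → (1 + (c + x)) * (r * f) ≡ r * (x + (1 + c)) * f
  regroup = solve-∀ ℚ-ring

fact-shift⟦⟧ : ∀ i e → fact (i ℕ.+ ⟦ e ⟧ℕ) ≡ rise i ⟦ e ⟧ℚ * fact ⟦ e ⟧ℕ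
fact-shift⟦⟧ i e = trans (fact-shift i ⟦ e ⟧ℕ) (cong (λ x → rise i x * fact ⟦ e ⟧ℕ) (ℕtoℚ-⟦⟧ e))

fact⁻¹-shift⟦⟧ : ∀ i e → fact⁻¹ ⟦ e ⟧ℕ ≡ rise i ⟦ e ⟧ℚ * fact⁻¹ (i ℕ.+ ⟦ e ⟧ℕ)
fact⁻¹-shift⟦⟧ i e = fact⁻¹-peel (rise i ⟦ e ⟧ℚ) (fact-shift⟦⟧ i e)

halfInv-inverse : ∀ z → halfInv z * (1 + 2 * ℤtoℚ z) ≡ 2
halfInv-inverse (+ n) =
  trans (cong (halfInv (+ n) *_) (sym (ℕtoℚ-⟦⟧ (` 1 :+ ` 2 :* ` n)))) (/-*-cancel (+ 2) (suc (2 ℕ.* n)))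
halfInv-inverse -[1+ n ] = begin
  h * (1 + 2 * ℤtoℚ -[1+ n ])         ≡⟨ cong (λ x → h * (1 + 2 * x)) (ℤtoℚ-homo‿- (+ suc n)) ⟩
  h * (1 + 2 * - ℕtoℚ (suc n))        ≡⟨ cong (λ x → h * (1 + 2 * - x)) (ℕtoℚ-homo-+ 1 n) ⟩
  h * (1 + 2 * - (1 + ℕtoℚ n))        ≡⟨ negate h (ℕtoℚ n) ⟩
  - (h * (1 + 2 * ℕtoℚ n))            ≡⟨ cong (λ x → - (h * x)) (sym (ℕtoℚ-⟦⟧ (` 1 :+ ` 2 :* ` n))) ⟩
  - (h * ℕtoℚ (suc (2 ℕ.* n)))        ≡⟨ cong -_ (/-*-cancel -[1+ 1 ] (suc (2 ℕ.* n))) ⟩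
  2                                   ∎
  where
  open ≡-Reasoning
  h = halfInv -[1+ n ]
  negate : ∀ h x → h * (1 + 2 * - (1 + x)) ≡ - (h * (1 + 2 * x))
  negate = solve-∀ ℚ-ring

halfInv-∸-inverse : ∀ m n → halfInv (+ m ℤ.- + n) * (1 + 2 * (ℕtoℚ m - ℕtoℚ n)) ≡ 2
halfInv-∸-inverse m n = subst (λ x → halfInv (+ m ℤ.- + n) * (1 + 2 * x) ≡ 2) (ℤtoℚ-∸ m n)
  (halfInv-inverse (+ m ℤ.- + n))

halfInv-suc-∸-suc : ∀ m n → halfInv (+ suc m ℤ.- + suc n) ≡ halfInv (+ m ℤ.- + n)
halfInv-suc-∸-suc m n = cong halfInv (shift (+ m) (+ n))
  where
  shift : ∀ x y → (ℤ.+ 1 ℤ.+ x) ℤ.- (ℤ.+ 1 ℤ.+ y) ≡ x ℤ.- y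
  shift = solve-∀ ℤ-Solver.ring

half-double : ∀ z → half z * 2 ≡ 1 + 2 * ℤtoℚ z
half-double z = begin
  half z * 2                       ≡⟨ /-*-cancel (+ 1 ℤ.+ + 2 ℤ.* z) 2 ⟩
  ℤtoℚ (+ 1 ℤ.+ + 2 ℤ.* z)         ≡⟨ ℤtoℚ-homo-+ (+ 1) (+ 2 ℤ.* z) ⟩
  1 + ℤtoℚ (+ 2 ℤ.* z)             ≡⟨ cong (λ x → 1 + x) (ℤtoℚ-homo-* (+ 2) z) ⟩
  1 + 2 * ℤtoℚ z                   ∎
  where open ≡-Reasoning

half-pos : ∀ m → half (+ m) ≡ (1 + 2 * ℕtoℚ m) * ½
half-pos m = begin
  half (+ m)                  ≡⟨ undo-halving (half (+ m)) ⟩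
  half (+ m) * 2 * ½          ≡⟨ cong (_* ½) (half-double (+ m)) ⟩
  (1 + 2 * ℕtoℚ m) * ½        ∎
  where
  open ≡-Reasoning
  undo-halving : ∀ x → x ≡ x * 2 * ½
  undo-halving = solve-∀ ℚ-ring

half-neg : ∀ m → half -[1+ m ] ≡ - half (+ m)
half-neg m = *-cancelˡ-ℕtoℚ 2 (begin
  2 * half -[1+ m ]                ≡⟨ ℚ.*-comm 2 (half -[1+ m ]) ⟩
  half -[1+ m ] * 2                ≡⟨ half-double -[1+ m ] ⟩
  1 + 2 * ℤtoℚ -[1+ m ]            ≡⟨ cong (λ x → 1 + 2 * x) (trans (ℤtoℚ-homo‿- (+ suc m)) (cong -_ (ℕtoℚ-homo-+ 1 m))) ⟩
  1 + 2 * - (1 + ℕtoℚ m)           ≡⟨ negate (ℕtoℚ m) ⟨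
  2 * - ((1 + 2 * ℕtoℚ m) * ½)     ≡⟨ cong (λ x → 2 * - x) (half-pos m) ⟨
  2 * - half (+ m)                 ∎)
  where
  open ≡-Reasoning
  negate : ∀ M → 2 * - ((1 + 2 * M) * ½) ≡ 1 + 2 * - (1 + M)
  negate = solve-∀ ℚ-ring

half-pos-∸ : ∀ b t → half (+ (b ℕ.+ t)) - ℕtoℚ t ≡ half (+ b)
half-pos-∸ b t = begin
  half (+ (b ℕ.+ t)) - ℕtoℚ t                        ≡⟨ cong (_- ℕtoℚ t) (half-pos (b ℕ.+ t)) ⟩
  (1 + 2 * ℕtoℚ (b ℕ.+ t)) * ½ - ℕtoℚ t              ≡⟨ cong (λ x → (1 + 2 * x) * ½ - ℕtoℚ t) (ℕtoℚ-homo-+ b t) ⟩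
  (1 + 2 * (ℕtoℚ b + ℕtoℚ t)) * ½ - ℕtoℚ t           ≡⟨ cancel (ℕtoℚ b) (ℕtoℚ t) ⟩
  (1 + 2 * ℕtoℚ b) * ½                               ≡⟨ half-pos b ⟨
  half (+ b)                                         ∎
  where
  open ≡-Reasoning
  cancel : ∀ B T → (1 + 2 * (B + T)) * ½ - T ≡ (1 + 2 * B) * ½
  cancel = solve-∀ ℚ-ring

via-halfInv : ∀ {x y} h c → x ≡ (h * c) * (y * ½) → h * c ≡ 2 → x ≡ y
via-halfInv {x} {y} h c x≡ hc≡2 = trans x≡ (trans (cong (_* (y * ½)) hc≡2) (halve y))
  where
  halve : ∀ y → 2 * (y * ½) ≡ y
  halve = solve-∀ ℚ-ring

sumTo-cong : ∀ n {f g : ℕ → ℚ} → (∀ μ → μ ≤ n → f μ ≡ g μ) → sumTo n f ≡ sumTo n g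
sumTo-cong zero    f≗g = f≗g 0 z≤n
sumTo-cong (suc n) f≗g =
  cong₂ _+_ (sumTo-cong n (λ μ μ≤n → f≗g μ (ℕ.m≤n⇒m≤1+n μ≤n))) (f≗g (suc n) ℕ.≤-refl)

sumTo-scale : ∀ n (f : ℕ → ℚ) a → a * sumTo n f ≡ sumTo n (λ μ → a * f μ)
sumTo-scale zero    f a = refl
sumTo-scale (suc n) f a =
  trans (ℚ.*-distribˡ-+ a (sumTo n f) (f (suc n))) (cong (_+ a * f (suc n)) (sumTo-scale n f a))

sumTo-linear : ∀ n (f g : ℕ → ℚ) a b →
               a * sumTo n f + b * sumTo n g ≡ sumTo n (λ μ → a * f μ + b * g μ)
sumTo-linear zero    f g a b = refl
sumTo-linear (suc n) f g a b = begin
  a * (sumTo n f + f (suc n)) + b * (sumTo n g + g (suc n))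
    ≡⟨ interchange a b (sumTo n f) (f (suc n)) (sumTo n g) (g (suc n)) ⟩
  (a * sumTo n f + b * sumTo n g) + (a * f (suc n) + b * g (suc n))
    ≡⟨ cong (_+ (a * f (suc n) + b * g (suc n))) (sumTo-linear n f g a b) ⟩
  sumTo n (λ μ → a * f μ + b * g μ) + (a * f (suc n) + b * g (suc n)) ∎
  where
  open ≡-Reasoning
  interchange : ∀ a b x y z w → a * (x + y) + b * (z + w) ≡ (a * x + b * z) + (a * y + b * w)
  interchange = solve-∀ ℚ-ring

sumTo-telescope : ∀ n (D E : ℕ → ℚ) → (∀ μ → μ < n → D μ ≡ E (suc μ)) →
                  sumTo n (λ μ → D μ - E μ) ≡ D n - E 0
sumTo-telescope zero    D E D≡E∘suc = refl
sumTo-telescope (suc n) D E D≡E∘suc = begin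
  sumTo n (λ μ → D μ - E μ) + (D (suc n) - E (suc n))
    ≡⟨ cong (_+ (D (suc n) - E (suc n))) (sumTo-telescope n D E (λ μ μ<n → D≡E∘suc μ (ℕ.m<n⇒m<1+n μ<n))) ⟩
  (D n - E 0) + (D (suc n) - E (suc n))
    ≡⟨ cong (λ x → (x - E 0) + (D (suc n) - E (suc n))) (D≡E∘suc n ℕ.≤-refl) ⟩
  (E (suc n) - E 0) + (D (suc n) - E (suc n))
    ≡⟨ cancel (E (suc n)) (E 0) (D (suc n)) ⟩
  D (suc n) - E 0 ∎
  where
  open ≡-Reasoning
  cancel : ∀ a b c → (a - b) + (c - a) ≡ c - b
  cancel = solve-∀ ℚ-ring

-- Identity (i)

coeff : ℕ → ℕ → ℚ
coeff n μ = sgn μ * fact (4 ℕ.* n ∸ 2 ℕ.* μ ∸ 1) * fact⁻¹ (2 ℕ.* (n ∸ μ))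
          * fact⁻¹ (2 ℕ.* n ∸ μ ∸ 1) * fact⁻¹ μ

coeff-indices : ∀ n μ a b d → 4 ℕ.* n ≡ a ℕ.+ 1 ℕ.+ 2 ℕ.* μ → 2 ℕ.* n ≡ b ℕ.+ 2 ℕ.* μ → 2 ℕ.* n ≡ d ℕ.+ 1 ℕ.+ μ →
  coeff n μ ≡ sgn μ * fact a * fact⁻¹ b * fact⁻¹ d * fact⁻¹ μ
coeff-indices n μ a b d eq₁ eq₂ eq₃
  rewrite m≡n+o⇒m∸o≡n (a ℕ.+ 1) (2 ℕ.* μ) eq₁ | m≡n+o⇒m∸o≡n a 1 refl
        | ℕ.*-distribˡ-∸ 2 n μ | m≡n+o⇒m∸o≡n b (2 ℕ.* μ) eq₂
        | m≡n+o⇒m∸o≡n (d ℕ.+ 1) μ eq₃ | m≡n+o⇒m∸o≡n d 1 refl = refl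

-- With n = 1 + m + k, every coefficient coeff (n + i) (m + i′) used below is a polynomial in m
-- and k times this common product.
coeff-frame : ℕ → ℕ → ℚ
coeff-frame m k = fact (1 ℕ.+ 2 ℕ.* m ℕ.+ 4 ℕ.* k) * fact⁻¹ (4 ℕ.+ 2 ℕ.* k)
          * fact⁻¹ (3 ℕ.+ m ℕ.+ 2 ℕ.* k) * fact⁻¹ (2 ℕ.+ m)

module _ (m k : ℕ) where
  private
    M K : ℚ
    M = ℕtoℚ m
    K = ℕtoℚ k
    a : ℕExpr
    a = ` 1 :+ ` 2 :* ` m :+ ` 4 :* ` k
    A = ⟦ a ⟧ℚ
    F₀ = fact ⟦ a ⟧ℕ
    I₁ = fact⁻¹ (4 ℕ.+ 2 ℕ.* k)
    I₂ = fact⁻¹ (3 ℕ.+ m ℕ.+ 2 ℕ.* k)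
    I₃ = fact⁻¹ (2 ℕ.+ m)

  coeff≡frame₀₀ : coeff (suc (m ℕ.+ k)) m ≡
    sgn m * (rise 2 A * rise 2 (2 + 2 * K) * rise 2 (1 + M + 2 * K) * rise 2 M) * coeff-frame m k
  coeff≡frame₀₀ = begin
    coeff (suc (m ℕ.+ k)) m
      ≡⟨ coeff-indices (suc (m ℕ.+ k)) m (2 ℕ.+ (1 ℕ.+ 2 ℕ.* m ℕ.+ 4 ℕ.* k)) (2 ℕ.+ 2 ℕ.* k) (1 ℕ.+ m ℕ.+ 2 ℕ.* k)
                 (ℕ-Solver.solve (m ∷ k ∷ [])) (ℕ-Solver.solve (m ∷ k ∷ [])) (ℕ-Solver.solve (m ∷ k ∷ [])) ⟩
    sgn m * fact (2 ℕ.+ (1 ℕ.+ 2 ℕ.* m ℕ.+ 4 ℕ.* k)) * fact⁻¹ (2 ℕ.+ 2 ℕ.* k) * fact⁻¹ (1 ℕ.+ m ℕ.+ 2 ℕ.* k) * fact⁻¹ m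
      ≡⟨ cong₄ (λ x y z w → sgn m * x * y * z * w)
               (fact-shift⟦⟧ 2 a) (fact⁻¹-shift⟦⟧ 2 (` 2 :+ ` 2 :* ` k))
               (fact⁻¹-shift⟦⟧ 2 (` 1 :+ ` m :+ ` 2 :* ` k)) (fact⁻¹-shift⟦⟧ 2 (` m)) ⟩
    sgn m * (rise 2 A * F₀) * (rise 2 (2 + 2 * K) * I₁) * (rise 2 (1 + M + 2 * K) * I₂) * (rise 2 M * I₃)
      ≡⟨ regroup (sgn m) F₀ I₁ I₂ I₃ (rise 2 A) (rise 2 (2 + 2 * K)) (rise 2 (1 + M + 2 * K)) (rise 2 M) ⟩
    sgn m * (rise 2 A * rise 2 (2 + 2 * K) * rise 2 (1 + M + 2 * K) * rise 2 M) * coeff-frame m k ∎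
    where
    open ≡-Reasoning
    regroup : ∀ s x y z w a b c d → s * (a * x) * (b * y) * (c * z) * (d * w) ≡ s * (a * b * c * d) * (x * y * z * w)
    regroup = solve-∀ ℚ-ring

  coeff≡frame₀₁ : coeff (suc (m ℕ.+ k)) (suc m) ≡
    sgn (suc m) * (rise 4 (2 * K) * rise 3 (M + 2 * K) * rise 1 (1 + M)) * coeff-frame m k
  coeff≡frame₀₁ = begin
    coeff (suc (m ℕ.+ k)) (suc m)
      ≡⟨ coeff-indices (suc (m ℕ.+ k)) (suc m) (1 ℕ.+ 2 ℕ.* m ℕ.+ 4 ℕ.* k) (2 ℕ.* k) (m ℕ.+ 2 ℕ.* k)
                 (ℕ-Solver.solve (m ∷ k ∷ [])) (ℕ-Solver.solve (m ∷ k ∷ [])) (ℕ-Solver.solve (m ∷ k ∷ [])) ⟩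
    sgn (suc m) * fact (1 ℕ.+ 2 ℕ.* m ℕ.+ 4 ℕ.* k) * fact⁻¹ (2 ℕ.* k) * fact⁻¹ (m ℕ.+ 2 ℕ.* k) * fact⁻¹ (suc m)
      ≡⟨ cong₃ (λ y z w → sgn (suc m) * fact (1 ℕ.+ 2 ℕ.* m ℕ.+ 4 ℕ.* k) * y * z * w)
               (fact⁻¹-shift⟦⟧ 4 (` 2 :* ` k)) (fact⁻¹-shift⟦⟧ 3 (` m :+ ` 2 :* ` k)) (fact⁻¹-shift⟦⟧ 1 (` 1 :+ ` m)) ⟩
    sgn (suc m) * fact (1 ℕ.+ 2 ℕ.* m ℕ.+ 4 ℕ.* k) * (rise 4 (2 * K) * I₁) * (rise 3 (M + 2 * K) * I₂) * (rise 1 (1 + M) * I₃)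
      ≡⟨ regroup (sgn (suc m)) F₀ I₁ I₂ I₃ (rise 4 (2 * K)) (rise 3 (M + 2 * K)) (rise 1 (1 + M)) ⟩
    sgn (suc m) * (rise 4 (2 * K) * rise 3 (M + 2 * K) * rise 1 (1 + M)) * coeff-frame m k ∎
    where
    open ≡-Reasoning
    regroup : ∀ s x y z w b c d → s * x * (b * y) * (c * z) * (d * w) ≡ s * (b * c * d) * (x * y * z * w)
    regroup = solve-∀ ℚ-ring

  coeff≡frame₁₁ : coeff (suc (suc (m ℕ.+ k))) (suc m) ≡
    sgn (suc m) * (rise 4 A * rise 2 (2 + 2 * K) * rise 1 (2 + M + 2 * K) * rise 1 (1 + M)) * coeff-frame m k
  coeff≡frame₁₁ = begin
    coeff (suc (suc (m ℕ.+ k))) (suc m)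
      ≡⟨ coeff-indices (suc (suc (m ℕ.+ k))) (suc m) (4 ℕ.+ (1 ℕ.+ 2 ℕ.* m ℕ.+ 4 ℕ.* k)) (2 ℕ.+ 2 ℕ.* k) (2 ℕ.+ m ℕ.+ 2 ℕ.* k)
                 (ℕ-Solver.solve (m ∷ k ∷ [])) (ℕ-Solver.solve (m ∷ k ∷ [])) (ℕ-Solver.solve (m ∷ k ∷ [])) ⟩
    sgn (suc m) * fact (4 ℕ.+ (1 ℕ.+ 2 ℕ.* m ℕ.+ 4 ℕ.* k)) * fact⁻¹ (2 ℕ.+ 2 ℕ.* k) * fact⁻¹ (2 ℕ.+ m ℕ.+ 2 ℕ.* k) * fact⁻¹ (suc m)
      ≡⟨ cong₄ (λ x y z w → sgn (suc m) * x * y * z * w)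
               (fact-shift⟦⟧ 4 a) (fact⁻¹-shift⟦⟧ 2 (` 2 :+ ` 2 :* ` k))
               (fact⁻¹-shift⟦⟧ 1 (` 2 :+ ` m :+ ` 2 :* ` k)) (fact⁻¹-shift⟦⟧ 1 (` 1 :+ ` m)) ⟩
    sgn (suc m) * (rise 4 A * F₀) * (rise 2 (2 + 2 * K) * I₁) * (rise 1 (2 + M + 2 * K) * I₂) * (rise 1 (1 + M) * I₃)
      ≡⟨ regroup (sgn (suc m)) F₀ I₁ I₂ I₃ (rise 4 A) (rise 2 (2 + 2 * K)) (rise 1 (2 + M + 2 * K)) (rise 1 (1 + M)) ⟩
    sgn (suc m) * (rise 4 A * rise 2 (2 + 2 * K) * rise 1 (2 + M + 2 * K) * rise 1 (1 + M)) * coeff-frame m k ∎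
    where
    open ≡-Reasoning
    regroup : ∀ s x y z w a b c d → s * (a * x) * (b * y) * (c * z) * (d * w) ≡ s * (a * b * c * d) * (x * y * z * w)
    regroup = solve-∀ ℚ-ring

  coeff≡frame₁₀ : coeff (suc (suc (m ℕ.+ k))) m ≡ sgn m * (rise 6 A * rise 2 M) * coeff-frame m k
  coeff≡frame₁₀ = begin
    coeff (suc (suc (m ℕ.+ k))) m
      ≡⟨ coeff-indices (suc (suc (m ℕ.+ k))) m (6 ℕ.+ (1 ℕ.+ 2 ℕ.* m ℕ.+ 4 ℕ.* k)) (4 ℕ.+ 2 ℕ.* k) (3 ℕ.+ m ℕ.+ 2 ℕ.* k)
                 (ℕ-Solver.solve (m ∷ k ∷ [])) (ℕ-Solver.solve (m ∷ k ∷ [])) (ℕ-Solver.solve (m ∷ k ∷ [])) ⟩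
    sgn m * fact (6 ℕ.+ (1 ℕ.+ 2 ℕ.* m ℕ.+ 4 ℕ.* k)) * fact⁻¹ (4 ℕ.+ 2 ℕ.* k) * fact⁻¹ (3 ℕ.+ m ℕ.+ 2 ℕ.* k) * fact⁻¹ m
      ≡⟨ cong₂ (λ x w → sgn m * x * I₁ * I₂ * w) (fact-shift⟦⟧ 6 a) (fact⁻¹-shift⟦⟧ 2 (` m)) ⟩
    sgn m * (rise 6 A * F₀) * I₁ * I₂ * (rise 2 M * I₃)
      ≡⟨ regroup (sgn m) F₀ I₁ I₂ I₃ (rise 6 A) (rise 2 M) ⟩
    sgn m * (rise 6 A * rise 2 M) * coeff-frame m k ∎
    where
    open ≡-Reasoning
    regroup : ∀ s x y z w a d → s * (a * x) * y * z * (d * w) ≡ s * (a * d) * (x * y * z * w)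
    regroup = solve-∀ ℚ-ring

  coeff≡frame₁₂ : coeff (suc (suc (m ℕ.+ k))) (suc (suc m)) ≡
    sgn (suc (suc m)) * (rise 2 A * rise 4 (2 * K) * rise 2 (1 + M + 2 * K)) * coeff-frame m k
  coeff≡frame₁₂ = begin
    coeff (suc (suc (m ℕ.+ k))) (suc (suc m))
      ≡⟨ coeff-indices (suc (suc (m ℕ.+ k))) (suc (suc m)) (2 ℕ.+ (1 ℕ.+ 2 ℕ.* m ℕ.+ 4 ℕ.* k)) (2 ℕ.* k) (1 ℕ.+ m ℕ.+ 2 ℕ.* k)
                 (ℕ-Solver.solve (m ∷ k ∷ [])) (ℕ-Solver.solve (m ∷ k ∷ [])) (ℕ-Solver.solve (m ∷ k ∷ [])) ⟩
    sgn (suc (suc m)) * fact (2 ℕ.+ ⟦ a ⟧ℕ) * fact⁻¹ (2 ℕ.* k) * fact⁻¹ (1 ℕ.+ m ℕ.+ 2 ℕ.* k) * I₃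
      ≡⟨ cong₃ (λ x y z → sgn (suc (suc m)) * x * y * z * I₃)
               (fact-shift⟦⟧ 2 a) (fact⁻¹-shift⟦⟧ 4 (` 2 :* ` k)) (fact⁻¹-shift⟦⟧ 2 (` 1 :+ ` m :+ ` 2 :* ` k)) ⟩
    sgn (suc (suc m)) * (rise 2 A * F₀) * (rise 4 (2 * K) * I₁) * (rise 2 (1 + M + 2 * K) * I₂) * I₃
      ≡⟨ regroup (sgn (suc (suc m))) F₀ I₁ I₂ I₃ (rise 2 A) (rise 4 (2 * K)) (rise 2 (1 + M + 2 * K)) ⟩
    sgn (suc (suc m)) * (rise 2 A * rise 4 (2 * K) * rise 2 (1 + M + 2 * K)) * coeff-frame m k ∎
    where
    open ≡-Reasoning
    regroup : ∀ s x y z w a b c → s * (a * x) * (b * y) * (c * z) * w ≡ s * (a * b * c) * (x * y * z * w)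
    regroup = solve-∀ ℚ-ring

summand : ℕ → ℕ → ℕ → ℚ
summand n j μ = coeff n μ * halfInv (+ μ ℤ.- + j)

lhs : ℕ → ℕ → ℚ
lhs n j = sumTo n (summand n j)

fact⁻¹ℤ : ℤ → ℚ
fact⁻¹ℤ (+ n)    = fact⁻¹ n
fact⁻¹ℤ -[1+ n ] = 0

opaque
  unfolding fact⁻¹

  invFact≡fact⁻¹ℤ : ∀ z → invFact z ≡ fact⁻¹ℤ z
  invFact≡fact⁻¹ℤ (+ n)    = refl
  invFact≡fact⁻¹ℤ -[1+ n ] = refl

rhs : ℕ → ℕ → ℚ
rhs n j = ℕtoℚ (2 ^ (4 ℕ.* n)) * sgn j * fact (2 ℕ.* n ∸ j) * fact j * fact⁻¹ (2 ℕ.* j)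
        * fact⁻¹ℤ (+ (2 ℕ.* n) ℤ.- + (2 ℕ.* j) ℤ.+ + 1)

-- Both sides satisfy  α n j · X (j + 1) + β n j · X j = 0.
α : ℕ → ℕ → ℕ
α n j = (2 ℕ.* n ∸ j) ℕ.* (1 ℕ.+ 2 ℕ.* j)

β : ℕ → ℕ → ℚ
β n j = (2 * ℕtoℚ n - 2 * ℕtoℚ j + 1) * (ℕtoℚ n - ℕtoℚ j)

ℕtoℚ-α : ∀ n j → j ≤ 2 ℕ.* n → ℕtoℚ (α n j) ≡ (2 * ℕtoℚ n - ℕtoℚ j) * (1 + 2 * ℕtoℚ j)
ℕtoℚ-α n j j≤2n = trans (ℕtoℚ-homo-* (2 ℕ.* n ∸ j) (1 ℕ.+ 2 ℕ.* j))
  (cong₂ _*_ (trans (ℕtoℚ-∸ j≤2n) (cong (_- ℕtoℚ j) (ℕtoℚ-homo-* 2 n))) (ℕtoℚ-⟦⟧ (` 1 :+ ` 2 :* ` j)))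

-- A Zeilberger certificate for the recurrence of lhs n j in j.
wzD wzE : ℕ → ℕ → ℕ → ℚ
wzD n j μ = coeff n μ * ((ℕtoℚ n - ℕtoℚ μ) * (2 * ℕtoℚ n - 2 * ℕtoℚ μ - 1)) * halfInv (+ μ ℤ.- + j)
wzE n j μ = - (coeff n μ * (ℕtoℚ μ * (4 * ℕtoℚ n + 1 - 2 * ℕtoℚ μ))) * halfInv (+ μ ℤ.- + suc j)

wz-summand : ∀ n j μ → j ≤ 2 ℕ.* n →
  ℕtoℚ (α n j) * summand n (suc j) μ + β n j * summand n j μ ≡ wzD n j μ - wzE n j μ
wz-summand n j μ j≤2n = begin
  ℕtoℚ (α n j) * (c * u) + β n j * (c * v)
    ≡⟨ cong (λ x → x * (c * u) + β n j * (c * v)) (ℕtoℚ-α n j j≤2n) ⟩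
  (2 * N - J) * (1 + 2 * J) * (c * u) + β n j * (c * v)
    ≡⟨ split c u v N M J ⟩
  wzD n j μ - wzE n j μ + c * (M + J - 2 * N) * (u * (1 + 2 * (M - (1 + J))) - v * (1 + 2 * (M - J)))
    ≡⟨ cong₂ (λ x y → wzD n j μ - wzE n j μ + c * (M + J - 2 * N) * (x - y)) hu hv ⟩
  wzD n j μ - wzE n j μ + c * (M + J - 2 * N) * (2 - 2)
    ≡⟨ vanish (wzD n j μ - wzE n j μ) (c * (M + J - 2 * N)) ⟩
  wzD n j μ - wzE n j μ ∎
  where
  open ≡-Reasoning
  c = coeff n μ
  u = halfInv (+ μ ℤ.- + suc j)
  v = halfInv (+ μ ℤ.- + j)
  N = ℕtoℚ n
  M = ℕtoℚ μ
  J = ℕtoℚ j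
  hu : u * (1 + 2 * (M - (1 + J))) ≡ 2
  hu = subst (λ x → u * (1 + 2 * (M - x)) ≡ 2) (ℕtoℚ-homo-+ 1 j) (halfInv-∸-inverse μ (suc j))
  hv : v * (1 + 2 * (M - J)) ≡ 2
  hv = halfInv-∸-inverse μ j
  split : ∀ c u v N M J →
    (2 * N - J) * (1 + 2 * J) * (c * u) + (2 * N - 2 * J + 1) * (N - J) * (c * v)
    ≡ c * ((N - M) * (2 * N - 2 * M - 1)) * v - - (c * (M * (4 * N + 1 - 2 * M))) * u
      + c * (M + J - 2 * N) * (u * (1 + 2 * (M - (1 + J))) - v * (1 + 2 * (M - J)))
  split = solve-∀ ℚ-ring
  vanish : ∀ x y → x + y * (2 - 2) ≡ x
  vanish = solve-∀ ℚ-ring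

ℕtoℚ-1+m+k : ∀ m k → ℕtoℚ (suc (m ℕ.+ k)) ≡ 1 + ℕtoℚ m + ℕtoℚ k
ℕtoℚ-1+m+k m k = ℕtoℚ-⟦⟧ (` 1 :+ ` m :+ ` k)

coeff-ratio : ∀ m k → let n = suc (m ℕ.+ k); N = ℕtoℚ n; M = ℕtoℚ m in
  coeff n (suc m) * ((1 + M) * (4 * N - 2 * M - 1)) ≡ - (coeff n m * ((N - M) * (2 * N - 2 * M - 1)))
coeff-ratio m k = begin
  coeff n (suc m) * ((1 + M) * (4 * N - 2 * M - 1))
    ≡⟨ cong₂ (λ c x → c * ((1 + M) * (4 * x - 2 * M - 1))) (coeff≡frame₀₁ m k) (ℕtoℚ-1+m+k m k) ⟩
  sgn (suc m) * (rise 4 (2 * K) * rise 3 (M + 2 * K) * rise 1 (1 + M)) * coeff-frame m k * ((1 + M) * (4 * (1 + M + K) - 2 * M - 1))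
    ≡⟨ identity (sgn m) (coeff-frame m k) M K ⟩
  - (sgn m * (rise 2 (1 + 2 * M + 4 * K) * rise 2 (2 + 2 * K) * rise 2 (1 + M + 2 * K) * rise 2 M) * coeff-frame m k
       * ((1 + M + K - M) * (2 * (1 + M + K) - 2 * M - 1)))
    ≡⟨ cong₂ (λ c x → - (c * ((x - M) * (2 * x - 2 * M - 1)))) (sym (coeff≡frame₀₀ m k)) (sym (ℕtoℚ-1+m+k m k)) ⟩
  - (coeff n m * ((N - M) * (2 * N - 2 * M - 1))) ∎
  where
  open ≡-Reasoning
  n = suc (m ℕ.+ k)
  N = ℕtoℚ n
  M = ℕtoℚ m
  K = ℕtoℚ k
  identity : ∀ s f M K →
    - s * ((2 * K + 1) * (2 * K + 2) * (2 * K + 3) * (2 * K + 4) * ((M + 2 * K + 1) * (M + 2 * K + 2) * (M + 2 * K + 3)) * (1 + M + 1)) * f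
      * ((1 + M) * (4 * (1 + M + K) - 2 * M - 1))
    ≡ - (s * ((1 + 2 * M + 4 * K + 1) * (1 + 2 * M + 4 * K + 2) * ((2 + 2 * K + 1) * (2 + 2 * K + 2))
                * ((1 + M + 2 * K + 1) * (1 + M + 2 * K + 2)) * ((M + 1) * (M + 2))) * f
           * ((1 + M + K - M) * (2 * (1 + M + K) - 2 * M - 1)))
  identity = solve-∀ ℚ-ring

wzD≡wzE∘suc : ∀ n j {μ} → μ < n → wzD n j μ ≡ wzE n j (suc μ)
wzD≡wzE∘suc _ j = <-by-offset (λ μ n → wzD n j μ ≡ wzE n j (suc μ)) step
  where
  step : ∀ μ k → wzD (suc (μ ℕ.+ k)) j μ ≡ wzE (suc (μ ℕ.+ k)) j (suc μ)
  step μ k = sym (begin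
    - (coeff n′ (suc μ) * (ℕtoℚ (suc μ) * (4 * N + 1 - 2 * ℕtoℚ (suc μ)))) * halfInv (+ suc μ ℤ.- + suc j)
      ≡⟨ cong₂ (λ x h → - (coeff n′ (suc μ) * (x * (4 * N + 1 - 2 * x))) * h) (ℕtoℚ-homo-+ 1 μ) (halfInv-suc-∸-suc μ j) ⟩
    - (coeff n′ (suc μ) * ((1 + M) * (4 * N + 1 - 2 * (1 + M)))) * h
      ≡⟨ simplify (coeff n′ (suc μ)) M N h ⟩
    - (coeff n′ (suc μ) * ((1 + M) * (4 * N - 2 * M - 1))) * h
      ≡⟨ cong (λ x → - x * h) (coeff-ratio μ k) ⟩
    - - (coeff n′ μ * ((N - M) * (2 * N - 2 * M - 1))) * h
      ≡⟨ double-negation (coeff n′ μ * ((N - M) * (2 * N - 2 * M - 1))) h ⟩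
    coeff n′ μ * ((N - M) * (2 * N - 2 * M - 1)) * h ∎)
    where
    open ≡-Reasoning
    n′ = suc (μ ℕ.+ k)
    N = ℕtoℚ n′
    M = ℕtoℚ μ
    h = halfInv (+ μ ℤ.- + j)
    simplify : ∀ c M N h → - (c * ((1 + M) * (4 * N + 1 - 2 * (1 + M)))) * h ≡ - (c * ((1 + M) * (4 * N - 2 * M - 1))) * h
    simplify = solve-∀ ℚ-ring
    double-negation : ∀ x h → - - x * h ≡ x * h
    double-negation = solve-∀ ℚ-ring

lhs-recurrence : ∀ n j → j < 2 ℕ.* n → ℕtoℚ (α n j) * lhs n (suc j) + β n j * lhs n j ≡ 0
lhs-recurrence n j j<2n = begin
  ℕtoℚ (α n j) * lhs n (suc j) + β n j * lhs n j
    ≡⟨ sumTo-linear n (summand n (suc j)) (summand n j) (ℕtoℚ (α n j)) (β n j) ⟩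
  sumTo n (λ μ → ℕtoℚ (α n j) * summand n (suc j) μ + β n j * summand n j μ)
    ≡⟨ sumTo-cong n (λ μ _ → wz-summand n j μ (ℕ.<⇒≤ j<2n)) ⟩
  sumTo n (λ μ → wzD n j μ - wzE n j μ)
    ≡⟨ sumTo-telescope n (wzD n j) (wzE n j) (λ μ → wzD≡wzE∘suc n j) ⟩
  wzD n j n - wzE n j 0
    ≡⟨ ends-vanish (coeff n n) (ℕtoℚ n) (2 * ℕtoℚ n - 2 * ℕtoℚ n - 1) (halfInv (+ n ℤ.- + j))
                   (coeff n 0) (4 * ℕtoℚ n + 1 - 2 * 0) (halfInv (+ 0 ℤ.- + suc j)) ⟩
  0 ∎
  where
  open ≡-Reasoning
  ends-vanish : ∀ c N x h c′ y h′ → c * ((N - N) * x) * h - - (c′ * (0 * y)) * h′ ≡ 0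
  ends-vanish = solve-∀ ℚ-ring

+p-q+1≡+r : ∀ p q r → p ℕ.+ 1 ≡ r ℕ.+ q → + p ℤ.- + q ℤ.+ + 1 ≡ + r
+p-q+1≡+r p q r eq = begin
  + p ℤ.- + q ℤ.+ + 1       ≡⟨ reorder (+ p) (+ q) ⟩
  + (p ℕ.+ 1) ℤ.- + q       ≡⟨ cong (λ x → + x ℤ.- + q) eq ⟩
  + r ℤ.+ + q ℤ.- + q       ≡⟨ cancel (+ r) (+ q) ⟩
  + r                       ∎
  where
  open ≡-Reasoning
  reorder : ∀ x y → x ℤ.- y ℤ.+ ℤ.+ 1 ≡ x ℤ.+ ℤ.+ 1 ℤ.- y
  reorder = solve-∀ ℤ-Solver.ring
  cancel : ∀ x y → x ℤ.+ y ℤ.- y ≡ x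
  cancel = solve-∀ ℤ-Solver.ring

+p-q+1≡-[1+r] : ∀ p r → + p ℤ.- + (p ℕ.+ 1 ℕ.+ suc r) ℤ.+ + 1 ≡ -[1+ r ]
+p-q+1≡-[1+r] p r = identity (+ p) (+ r)
  where
  identity : ∀ x y → x ℤ.- (x ℤ.+ ℤ.+ 1 ℤ.+ (ℤ.+ 1 ℤ.+ y)) ℤ.+ ℤ.+ 1 ≡ ℤ.- (ℤ.+ 1 ℤ.+ y)
  identity = solve-∀ ℤ-Solver.ring

rhs-indices : ∀ n j a b → 2 ℕ.* n ≡ a ℕ.+ j → 2 ℕ.* n ℕ.+ 1 ≡ b ℕ.+ 2 ℕ.* j →
  rhs n j ≡ ℕtoℚ (2 ^ (4 ℕ.* n)) * sgn j * fact a * fact j * fact⁻¹ (2 ℕ.* j) * fact⁻¹ b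
rhs-indices n j a b eq₁ eq₂ rewrite m≡n+o⇒m∸o≡n a j eq₁ | +p-q+1≡+r (2 ℕ.* n) (2 ℕ.* j) b eq₂ = refl

rhs-vanishes : ∀ n j → n < j → rhs n j ≡ 0
rhs-vanishes n j n<j = begin
  rhs n j                        ≡⟨ cong (λ z → P * fact⁻¹ℤ z) (trans (cong (λ x → + (2 ℕ.* n) ℤ.- + x ℤ.+ + 1) 2j≡) (+p-q+1≡-[1+r] (2 ℕ.* n) (2 ℕ.* t))) ⟩
  P * 0                          ≡⟨ ℚ.*-zeroʳ P ⟩
  0                              ∎
  where
  open ≡-Reasoning
  P = ℕtoℚ (2 ^ (4 ℕ.* n)) * sgn j * fact (2 ℕ.* n ∸ j) * fact j * fact⁻¹ (2 ℕ.* j)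
  t = j ∸ suc n
  2j≡ : 2 ℕ.* j ≡ 2 ℕ.* n ℕ.+ 1 ℕ.+ suc (2 ℕ.* t)
  2j≡ = trans (cong (2 ℕ.*_) (sym (ℕ.m+[n∸m]≡n n<j))) (double n t)
    where
    double : ∀ n t → 2 ℕ.* (suc n ℕ.+ t) ≡ 2 ℕ.* n ℕ.+ 1 ℕ.+ suc (2 ℕ.* t)
    double = ℕ-Solver.solve-∀

-- The same for rhs n j and rhs n (j + 1), with n = 1 + j + k.
rhs-frame : ℕ → ℕ → ℚ
rhs-frame j k = fact (1 ℕ.+ j ℕ.+ 2 ℕ.* k) * fact j * fact⁻¹ (2 ℕ.+ 2 ℕ.* j) * fact⁻¹ (3 ℕ.+ 2 ℕ.* k)

module _ (j k : ℕ) where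
  private
    J K P : ℚ
    J = ℕtoℚ j
    K = ℕtoℚ k
    P = ℕtoℚ (2 ^ (4 ℕ.* suc (j ℕ.+ k)))
    e : ℕExpr
    e = ` 1 :+ ` j :+ ` 2 :* ` k

  rhs≡frame₀ : rhs (suc (j ℕ.+ k)) j ≡ P * sgn j * (rise 1 ⟦ e ⟧ℚ * rise 2 (2 * J)) * rhs-frame j k
  rhs≡frame₀ = begin
    rhs (suc (j ℕ.+ k)) j
      ≡⟨ rhs-indices (suc (j ℕ.+ k)) j (1 ℕ.+ (1 ℕ.+ j ℕ.+ 2 ℕ.* k)) (3 ℕ.+ 2 ℕ.* k) (ℕ-Solver.solve (j ∷ k ∷ [])) (ℕ-Solver.solve (j ∷ k ∷ [])) ⟩
    P * sgn j * fact (1 ℕ.+ ⟦ e ⟧ℕ) * fact j * fact⁻¹ (2 ℕ.* j) * fact⁻¹ (3 ℕ.+ 2 ℕ.* k)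
      ≡⟨ cong₂ (λ x y → P * sgn j * x * fact j * y * fact⁻¹ (3 ℕ.+ 2 ℕ.* k)) (fact-shift⟦⟧ 1 e) (fact⁻¹-shift⟦⟧ 2 (` 2 :* ` j)) ⟩
    P * sgn j * (rise 1 ⟦ e ⟧ℚ * fact ⟦ e ⟧ℕ) * fact j * (rise 2 (2 * J) * fact⁻¹ (2 ℕ.+ 2 ℕ.* j)) * fact⁻¹ (3 ℕ.+ 2 ℕ.* k)
      ≡⟨ regroup P (sgn j) (fact ⟦ e ⟧ℕ) (fact j) (fact⁻¹ (2 ℕ.+ 2 ℕ.* j)) (fact⁻¹ (3 ℕ.+ 2 ℕ.* k)) (rise 1 ⟦ e ⟧ℚ) (rise 2 (2 * J)) ⟩
    P * sgn j * (rise 1 ⟦ e ⟧ℚ * rise 2 (2 * J)) * rhs-frame j k ∎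
    where
    open ≡-Reasoning
    regroup : ∀ p s x y z w a c → p * s * (a * x) * y * (c * z) * w ≡ p * s * (a * c) * (x * y * z * w)
    regroup = solve-∀ ℚ-ring

  rhs≡frame₁ : rhs (suc (j ℕ.+ k)) (suc j) ≡ P * sgn (suc j) * (rise 1 J * rise 2 (1 + 2 * K)) * rhs-frame j k
  rhs≡frame₁ = begin
    rhs (suc (j ℕ.+ k)) (suc j)
      ≡⟨ rhs-indices (suc (j ℕ.+ k)) (suc j) (1 ℕ.+ j ℕ.+ 2 ℕ.* k) (1 ℕ.+ 2 ℕ.* k) (ℕ-Solver.solve (j ∷ k ∷ [])) (ℕ-Solver.solve (j ∷ k ∷ [])) ⟩
    P * sgn (suc j) * fact ⟦ e ⟧ℕ * fact (1 ℕ.+ j) * fact⁻¹ (2 ℕ.* suc j) * fact⁻¹ (1 ℕ.+ 2 ℕ.* k)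
      ≡⟨ cong₃ (λ x y z → P * sgn (suc j) * fact ⟦ e ⟧ℕ * x * y * z)
               (fact-shift 1 j) (cong fact⁻¹ (ℕ-Solver.solve (j ∷ []))) (fact⁻¹-shift⟦⟧ 2 (` 1 :+ ` 2 :* ` k)) ⟩
    P * sgn (suc j) * fact ⟦ e ⟧ℕ * (rise 1 J * fact j) * fact⁻¹ (2 ℕ.+ 2 ℕ.* j) * (rise 2 (1 + 2 * K) * fact⁻¹ (3 ℕ.+ 2 ℕ.* k))
      ≡⟨ regroup P (sgn (suc j)) (fact ⟦ e ⟧ℕ) (fact j) (fact⁻¹ (2 ℕ.+ 2 ℕ.* j)) (fact⁻¹ (3 ℕ.+ 2 ℕ.* k)) (rise 1 J) (rise 2 (1 + 2 * K)) ⟩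
    P * sgn (suc j) * (rise 1 J * rise 2 (1 + 2 * K)) * rhs-frame j k ∎
    where
    open ≡-Reasoning
    regroup : ∀ p s x y z w b d → p * s * x * (b * y) * z * (d * w) ≡ p * s * (b * d) * (x * y * z * w)
    regroup = solve-∀ ℚ-ring

rhs-recurrence : ∀ n j → ℕtoℚ (α n j) * rhs n (suc j) + β n j * rhs n j ≡ 0
rhs-recurrence n j with ℕ.<-cmp j n
... | tri< j<n _ _ = <-by-offset (λ j n → ℕtoℚ (α n j) * rhs n (suc j) + β n j * rhs n j ≡ 0) below j<n
  where
  below : ∀ j k → ℕtoℚ (α (suc (j ℕ.+ k)) j) * rhs (suc (j ℕ.+ k)) (suc j) + β (suc (j ℕ.+ k)) j * rhs (suc (j ℕ.+ k)) j ≡ 0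
  below j k = begin
    ℕtoℚ (α n′ j) * rhs n′ (suc j) + β n′ j * rhs n′ j
      ≡⟨ cong₃ (λ a x y → a * x + β n′ j * y) (ℕtoℚ-α n′ j j≤2n) (rhs≡frame₁ j k) (rhs≡frame₀ j k) ⟩
    (2 * N - J) * (1 + 2 * J) * R₁ + (2 * N - 2 * J + 1) * (N - J) * R₀
      ≡⟨ cong (λ N → (2 * N - J) * (1 + 2 * J) * R₁ + (2 * N - 2 * J + 1) * (N - J) * R₀) (ℕtoℚ-1+m+k j k) ⟩
    (2 * (1 + J + K) - J) * (1 + 2 * J) * R₁ + (2 * (1 + J + K) - 2 * J + 1) * (1 + J + K - J) * R₀
      ≡⟨ identity (ℕtoℚ (2 ^ (4 ℕ.* n′))) (sgn j) (rhs-frame j k) J K ⟩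
    0 ∎
    where
    open ≡-Reasoning
    n′ = suc (j ℕ.+ k)
    N = ℕtoℚ n′
    J = ℕtoℚ j
    K = ℕtoℚ k
    R₀ = ℕtoℚ (2 ^ (4 ℕ.* n′)) * sgn j * (rise 1 (1 + J + 2 * K) * rise 2 (2 * J)) * rhs-frame j k
    R₁ = ℕtoℚ (2 ^ (4 ℕ.* n′)) * sgn (suc j) * (rise 1 J * rise 2 (1 + 2 * K)) * rhs-frame j k
    j≤2n : j ≤ 2 ℕ.* n′
    j≤2n = ℕ.≤-trans (ℕ.m≤m+n j k) (ℕ.≤-trans (ℕ.n≤1+n _) (ℕ.m≤n*m n′ 2))
    identity : ∀ P s f J K →
      (2 * (1 + J + K) - J) * (1 + 2 * J) * (P * - s * ((J + 1) * ((1 + 2 * K + 1) * (1 + 2 * K + 2))) * f)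
        + (2 * (1 + J + K) - 2 * J + 1) * (1 + J + K - J) * (P * s * ((1 + J + 2 * K + 1) * ((2 * J + 1) * (2 * J + 2))) * f)
      ≡ 0
    identity = solve-∀ ℚ-ring
... | tri≈ _ refl _ = begin
  ℕtoℚ (α n n) * rhs n (suc n) + β n n * rhs n n
    ≡⟨ cong (λ x → ℕtoℚ (α n n) * x + β n n * rhs n n) (rhs-vanishes n (suc n) (ℕ.n<1+n n)) ⟩
  ℕtoℚ (α n n) * 0 + (2 * N - 2 * N + 1) * (N - N) * rhs n n
    ≡⟨ identity (ℕtoℚ (α n n)) (2 * N - 2 * N + 1) N (rhs n n) ⟩
  0 ∎
  where
  open ≡-Reasoning
  N = ℕtoℚ n
  identity : ∀ a b N r → a * 0 + b * (N - N) * r ≡ 0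
  identity = solve-∀ ℚ-ring
... | tri> _ _ n<j = begin
  ℕtoℚ (α n j) * rhs n (suc j) + β n j * rhs n j
    ≡⟨ cong₂ (λ x y → ℕtoℚ (α n j) * x + β n j * y) (rhs-vanishes n (suc j) (ℕ.m<n⇒m<1+n n<j)) (rhs-vanishes n j n<j) ⟩
  ℕtoℚ (α n j) * 0 + β n j * 0
    ≡⟨ identity (ℕtoℚ (α n j)) (β n j) ⟩
  0 ∎
  where
  open ≡-Reasoning
  identity : ∀ a b → a * 0 + b * 0 ≡ 0
  identity = solve-∀ ℚ-ring

recurrence-unique : ∀ a .{{_ : NonZero a}} b {x y x′ y′} →
  ℕtoℚ a * x + b * y ≡ 0 → ℕtoℚ a * x′ + b * y′ ≡ 0 → y ≡ y′ → x ≡ x′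
recurrence-unique a b {x} {y} {x′} {y′} eq eq′ refl = *-cancelˡ-ℕtoℚ a (begin
  ℕtoℚ a * x                      ≡⟨ isolate (ℕtoℚ a * x) (b * y) ⟩
  (ℕtoℚ a * x + b * y) - b * y    ≡⟨ cong (_- b * y) (trans eq (sym eq′)) ⟩
  (ℕtoℚ a * x′ + b * y) - b * y   ≡⟨ isolate (ℕtoℚ a * x′) (b * y) ⟨
  ℕtoℚ a * x′                     ∎)
  where
  open ≡-Reasoning
  isolate : ∀ u v → u ≡ (u + v) - v
  isolate = solve-∀ ℚ-ring

lhs≡rhs-from-base : ∀ n → lhs n 0 ≡ rhs n 0 → ∀ j → j ≤ 2 ℕ.* n → lhs n j ≡ rhs n j
lhs≡rhs-from-base n base zero    _    = base
lhs≡rhs-from-base n base (suc j) j<2n = recurrence-unique (α n j) {{α≢0}} (β n j)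
  (lhs-recurrence n j j<2n) (rhs-recurrence n j) (lhs≡rhs-from-base n base j (ℕ.<⇒≤ j<2n))
  where
  α≢0 : NonZero (α n j)
  α≢0 = ℕ.m*n≢0 (2 ℕ.* n ∸ j) (1 ℕ.+ 2 ℕ.* j) {{ℕ.>-nonZero (ℕ.m<n⇒0<n∸m j<2n)}}

lead trail wzA wzB : ℚ → ℚ
lead  N = (N + 1) * (2 * N + 1) * (2 * N + 3)
trail N = 16 * (N + 1) * (2 * N + 1) * (2 * N + 1)
wzA   N = 32 * N * N + 28 * N + 2
wzB   N = 24 * N + 20

-- A Zeilberger certificate for the recurrence lead (ℕtoℚ n) · lhs (n + 1) 0 = trail (ℕtoℚ n) · lhs n 0.
wzG : ℕ → ℕ → ℚ
wzG n μ = 2 * coeff n μ * (wzA (ℕtoℚ n) - wzB (ℕtoℚ n) * ℕtoℚ μ)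

wzG-inner : ∀ m k → let n = suc (m ℕ.+ k) in
  lead (ℕtoℚ n) * summand (suc n) 0 (suc m) + - trail (ℕtoℚ n) * summand n 0 (suc m) ≡ wzG n (suc m) - wzG n m
wzG-inner m k = begin
  lead (ℕtoℚ n) * (coeff (suc n) (suc m) * h) + - trail (ℕtoℚ n) * (coeff n (suc m) * h)
    ≡⟨ cong₃ (λ N x y → lead N * (x * h) + - trail N * (y * h)) (ℕtoℚ-1+m+k m k) (coeff≡frame₁₁ m k) (coeff≡frame₀₁ m k) ⟩
  lead N * (sgn (suc m) * P₁₁ * coeff-frame m k * h) + - trail N * (sgn (suc m) * P₀₁ * coeff-frame m k * h)
    ≡⟨ via-halfInv h (1 + 2 * (1 + M - 0)) (identity (sgn m) (coeff-frame m k) M K h) h-inverse ⟩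
  2 * (sgn (suc m) * P₀₁ * coeff-frame m k) * (wzA N - wzB N * (1 + M)) - 2 * (sgn m * P₀₀ * coeff-frame m k) * (wzA N - wzB N * M)
    ≡⟨ cong₄ (λ N x y M′ → 2 * x * (wzA N - wzB N * M′) - 2 * y * (wzA N - wzB N * M))
             (sym (ℕtoℚ-1+m+k m k)) (sym (coeff≡frame₀₁ m k)) (sym (coeff≡frame₀₀ m k)) (sym (ℕtoℚ-homo-+ 1 m)) ⟩
  wzG n (suc m) - wzG n m ∎
  where
  open ≡-Reasoning
  n = suc (m ℕ.+ k)
  M = ℕtoℚ m
  K = ℕtoℚ k
  N = 1 + M + K
  h = halfInv (+ suc m ℤ.- + 0)
  P₀₀ = rise 2 (1 + 2 * M + 4 * K) * rise 2 (2 + 2 * K) * rise 2 (1 + M + 2 * K) * rise 2 M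
  P₀₁ = rise 4 (2 * K) * rise 3 (M + 2 * K) * rise 1 (1 + M)
  P₁₁ = rise 4 (1 + 2 * M + 4 * K) * rise 2 (2 + 2 * K) * rise 1 (2 + M + 2 * K) * rise 1 (1 + M)
  h-inverse : h * (1 + 2 * (1 + M - 0)) ≡ 2
  h-inverse = subst (λ x → h * (1 + 2 * (x - 0)) ≡ 2) (ℕtoℚ-homo-+ 1 m) (halfInv-∸-inverse (suc m) 0)
  identity : ∀ s f M K h → let N = 1 + M + K; A = 1 + 2 * M + 4 * K in
    (N + 1) * (2 * N + 1) * (2 * N + 3)
      * (- s * ((A + 1) * (A + 2) * (A + 3) * (A + 4) * ((2 + 2 * K + 1) * (2 + 2 * K + 2)) * (2 + M + 2 * K + 1) * (1 + M + 1)) * f * h)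
    + - (16 * (N + 1) * (2 * N + 1) * (2 * N + 1))
      * (- s * ((2 * K + 1) * (2 * K + 2) * (2 * K + 3) * (2 * K + 4) * ((M + 2 * K + 1) * (M + 2 * K + 2) * (M + 2 * K + 3)) * (1 + M + 1)) * f * h)
    ≡ (h * (1 + 2 * (1 + M - 0)))
      * ((2 * (- s * ((2 * K + 1) * (2 * K + 2) * (2 * K + 3) * (2 * K + 4) * ((M + 2 * K + 1) * (M + 2 * K + 2) * (M + 2 * K + 3)) * (1 + M + 1)) * f)
            * (32 * N * N + 28 * N + 2 - (24 * N + 20) * (1 + M))
          - 2 * (s * ((A + 1) * (A + 2) * ((2 + 2 * K + 1) * (2 + 2 * K + 2)) * ((1 + M + 2 * K + 1) * (1 + M + 2 * K + 2)) * ((M + 1) * (M + 2))) * f)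
            * (32 * N * N + 28 * N + 2 - (24 * N + 20) * M))
         * ½)
  identity = solve-∀ ℚ-ring

wzG-first : ∀ k → let n = suc k in
  lead (ℕtoℚ n) * summand (suc n) 0 0 + - trail (ℕtoℚ n) * summand n 0 0 ≡ wzG n 0 - 0
wzG-first k = begin
  lead (ℕtoℚ (suc k)) * (coeff (2 ℕ.+ k) 0 * 2) + - trail (ℕtoℚ (suc k)) * (coeff (suc k) 0 * 2)
    ≡⟨ cong₃ (λ N x y → lead N * (x * 2) + - trail N * (y * 2)) (ℕtoℚ-homo-+ 1 k) (coeff≡frame₁₀ 0 k) (coeff≡frame₀₀ 0 k) ⟩
  lead (1 + K) * (P₁₀ * coeff-frame 0 k * 2) + - trail (1 + K) * (P₀₀ * coeff-frame 0 k * 2)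
    ≡⟨ identity (coeff-frame 0 k) K ⟩
  2 * (P₀₀ * coeff-frame 0 k) * (wzA (1 + K) - wzB (1 + K) * 0) - 0
    ≡⟨ cong₂ (λ N x → 2 * x * (wzA N - wzB N * 0) - 0) (sym (ℕtoℚ-homo-+ 1 k)) (sym (coeff≡frame₀₀ 0 k)) ⟩
  wzG (suc k) 0 - 0 ∎
  where
  open ≡-Reasoning
  K = ℕtoℚ k
  P₀₀ = sgn 0 * (rise 2 (1 + 2 * 0 + 4 * K) * rise 2 (2 + 2 * K) * rise 2 (1 + 0 + 2 * K) * rise 2 0)
  P₁₀ = sgn 0 * (rise 6 (1 + 2 * 0 + 4 * K) * rise 2 0)
  identity : ∀ f K → let N = 1 + K; A = 1 + 2 * 0 + 4 * K in
    (N + 1) * (2 * N + 1) * (2 * N + 3)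
      * (1 * ((A + 1) * (A + 2) * (A + 3) * (A + 4) * (A + 5) * (A + 6) * ((0 + 1) * (0 + 2))) * f * 2)
    + - (16 * (N + 1) * (2 * N + 1) * (2 * N + 1))
      * (1 * ((A + 1) * (A + 2) * ((2 + 2 * K + 1) * (2 + 2 * K + 2)) * ((1 + 0 + 2 * K + 1) * (1 + 0 + 2 * K + 2)) * ((0 + 1) * (0 + 2))) * f * 2)
    ≡ 2 * (1 * ((A + 1) * (A + 2) * ((2 + 2 * K + 1) * (2 + 2 * K + 2)) * ((1 + 0 + 2 * K + 1) * (1 + 0 + 2 * K + 2)) * ((0 + 1) * (0 + 2))) * f)
        * (32 * N * N + 28 * N + 2 - (24 * N + 20) * 0) - 0
  identity = solve-∀ ℚ-ring

wzG-top : ∀ k → let n = suc k in lead (ℕtoℚ n) * summand (suc n) 0 (suc n) ≡ - wzG n n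
wzG-top k = begin
  lead (ℕtoℚ (suc k)) * (coeff (2 ℕ.+ k) (2 ℕ.+ k) * h)
    ≡⟨ cong₂ (λ N x → lead N * (x * h)) (ℕtoℚ-homo-+ 1 k) (trans (cong (λ x → coeff (suc (suc x)) (2 ℕ.+ k)) (sym (ℕ.+-identityʳ k))) (coeff≡frame₁₂ k 0)) ⟩
  lead (1 + M) * (sgn (2 ℕ.+ k) * P₁₂ * coeff-frame k 0 * h)
    ≡⟨ via-halfInv h (1 + 2 * (2 + M - 0)) (identity (sgn k) (coeff-frame k 0) M h) h-inverse ⟩
  - (2 * (sgn (suc k) * P₀₁ * coeff-frame k 0) * (wzA (1 + M) - wzB (1 + M) * (1 + M)))
    ≡⟨ cong₂ (λ N x → - (2 * x * (wzA N - wzB N * N))) (sym (ℕtoℚ-homo-+ 1 k))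
             (sym (trans (cong (λ x → coeff (suc x) (suc k)) (sym (ℕ.+-identityʳ k))) (coeff≡frame₀₁ k 0))) ⟩
  - wzG (suc k) (suc k) ∎
  where
  open ≡-Reasoning
  M = ℕtoℚ k
  h = halfInv (+ suc (suc k) ℤ.- + 0)
  P₀₁ = rise 4 (2 * ℕtoℚ 0) * rise 3 (M + 2 * ℕtoℚ 0) * rise 1 (1 + M)
  P₁₂ = rise 2 (1 + 2 * M + 4 * ℕtoℚ 0) * rise 4 (2 * ℕtoℚ 0) * rise 2 (1 + M + 2 * ℕtoℚ 0)
  h-inverse : h * (1 + 2 * (2 + M - 0)) ≡ 2
  h-inverse = subst (λ x → h * (1 + 2 * (x - 0)) ≡ 2) (ℕtoℚ-homo-+ 2 k) (halfInv-∸-inverse (suc (suc k)) 0)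
  identity : ∀ s f M h → let N = 1 + M in
    (N + 1) * (2 * N + 1) * (2 * N + 3)
      * (- - s * ((1 + 2 * M + 4 * 0 + 1) * (1 + 2 * M + 4 * 0 + 2) * ((2 * 0 + 1) * (2 * 0 + 2) * (2 * 0 + 3) * (2 * 0 + 4))
                  * ((1 + M + 2 * 0 + 1) * (1 + M + 2 * 0 + 2))) * f * h)
    ≡ (h * (1 + 2 * (2 + M - 0)))
      * (- (2 * (- s * ((2 * 0 + 1) * (2 * 0 + 2) * (2 * 0 + 3) * (2 * 0 + 4) * ((M + 2 * 0 + 1) * (M + 2 * 0 + 2) * (M + 2 * 0 + 3)) * (1 + M + 1)) * f)
            * (32 * N * N + 28 * N + 2 - (24 * N + 20) * N))
         * ½)
  identity = solve-∀ ℚ-ring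

lhs₀-recurrence : ∀ k → let N = ℕtoℚ (suc k) in lead N * lhs (2 ℕ.+ k) 0 ≡ trail N * lhs (suc k) 0
lhs₀-recurrence k = begin
  a * (sumTo n f₁ + f₁ (suc n))                      ≡⟨ split a b (sumTo n f₁) (f₁ (suc n)) (sumTo n f₀) ⟩
  (a * sumTo n f₁ + - b * sumTo n f₀) + a * f₁ (suc n) + b * sumTo n f₀
    ≡⟨ cong (λ x → x + a * f₁ (suc n) + b * sumTo n f₀) (sumTo-linear n f₁ f₀ a (- b)) ⟩
  sumTo n (λ μ → a * f₁ μ + - b * f₀ μ) + a * f₁ (suc n) + b * sumTo n f₀
    ≡⟨ cong₂ (λ x y → x + y + b * sumTo n f₀) (sumTo-cong n pointwise) (wzG-top k) ⟩
  sumTo n (λ μ → wzG n μ - wzG′ μ) + - wzG n n + b * sumTo n f₀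
    ≡⟨ cong (λ x → x + - wzG n n + b * sumTo n f₀) (sumTo-telescope n (wzG n) wzG′ (λ _ _ → refl)) ⟩
  wzG n n - 0 + - wzG n n + b * sumTo n f₀        ≡⟨ cancel (wzG n n) (b * sumTo n f₀) ⟩
  b * sumTo n f₀                                   ∎
  where
  open ≡-Reasoning
  n = suc k
  a = lead (ℕtoℚ n)
  b = trail (ℕtoℚ n)
  f₀ = summand n 0
  f₁ = summand (suc n) 0
  wzG′ : ℕ → ℚ
  wzG′ zero    = 0
  wzG′ (suc μ) = wzG n μ
  pointwise : ∀ μ → μ ≤ n → a * f₁ μ + - b * f₀ μ ≡ wzG n μ - wzG′ μ
  pointwise zero    _   = wzG-first k
  pointwise (suc m) m<n = <-by-offset
    (λ m n → lead (ℕtoℚ n) * summand (suc n) 0 (suc m) + - trail (ℕtoℚ n) * summand n 0 (suc m) ≡ wzG n (suc m) - wzG n m)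
    wzG-inner m<n
  split : ∀ a b s x t → a * (s + x) ≡ (a * s + - b * t) + a * x + b * t
  split = solve-∀ ℚ-ring
  cancel : ∀ g y → g - 0 + - g + y ≡ y
  cancel = solve-∀ ℚ-ring

opaque
  unfolding fact fact⁻¹

  3*lhs-1-0≡16 : 3 * lhs 1 0 ≡ 16
  3*lhs-1-0≡16 = refl

ℕtoℚ-2^4[1+n] : ∀ n → ℕtoℚ (2 ^ (4 ℕ.* suc n)) ≡ 16 * ℕtoℚ (2 ^ (4 ℕ.* n))
ℕtoℚ-2^4[1+n] n = trans (cong (λ e → ℕtoℚ (2 ^ e)) (ℕ.*-suc 4 n))
                   (trans (cong ℕtoℚ (ℕ.^-distribˡ-+-* 2 4 (4 ℕ.* n))) (ℕtoℚ-homo-* 16 (2 ^ (4 ℕ.* n))))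

lhs₀-closed : ∀ k → let n = suc k in ℕtoℚ (1 ℕ.+ 2 ℕ.* n) * lhs n 0 ≡ ℕtoℚ (2 ^ (4 ℕ.* n))
lhs₀-closed zero    = 3*lhs-1-0≡16
lhs₀-closed (suc k) = *-cancelˡ-ℕtoℚ (suc n ℕ.* (1 ℕ.+ 2 ℕ.* n)) (begin
  ℕtoℚ (suc n ℕ.* (1 ℕ.+ 2 ℕ.* n)) * (ℕtoℚ (1 ℕ.+ 2 ℕ.* suc n) * lhs (suc n) 0)
    ≡⟨ cong₂ (λ x y → x * (y * lhs (suc n) 0)) (ℕtoℚ-⟦⟧ ((` 1 :+ ` n) :* (` 1 :+ ` 2 :* ` n))) (ℕtoℚ-⟦⟧ (` 1 :+ ` 2 :* (` 1 :+ ` n))) ⟩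
  (1 + N) * (1 + 2 * N) * ((1 + 2 * (1 + N)) * lhs (suc n) 0)
    ≡⟨ as-lead N (lhs (suc n) 0) ⟩
  lead N * lhs (suc n) 0
    ≡⟨ lhs₀-recurrence k ⟩
  trail N * lhs n 0
    ≡⟨ as-trail N (lhs n 0) ⟩
  16 * ((1 + N) * (1 + 2 * N)) * ((1 + 2 * N) * lhs n 0)
    ≡⟨ cong (λ x → 16 * ((1 + N) * (1 + 2 * N)) * (x * lhs n 0)) (sym (ℕtoℚ-⟦⟧ (` 1 :+ ` 2 :* ` n))) ⟩
  16 * ((1 + N) * (1 + 2 * N)) * (ℕtoℚ (1 ℕ.+ 2 ℕ.* n) * lhs n 0)
    ≡⟨ cong (λ x → 16 * ((1 + N) * (1 + 2 * N)) * x) (lhs₀-closed k) ⟩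
  16 * ((1 + N) * (1 + 2 * N)) * ℕtoℚ (2 ^ (4 ℕ.* n))
    ≡⟨ reorder ((1 + N) * (1 + 2 * N)) (ℕtoℚ (2 ^ (4 ℕ.* n))) ⟩
  ((1 + N) * (1 + 2 * N)) * (16 * ℕtoℚ (2 ^ (4 ℕ.* n)))
    ≡⟨ cong₂ _*_ (sym (ℕtoℚ-⟦⟧ ((` 1 :+ ` n) :* (` 1 :+ ` 2 :* ` n)))) (sym (ℕtoℚ-2^4[1+n] n)) ⟩
  ℕtoℚ (suc n ℕ.* (1 ℕ.+ 2 ℕ.* n)) * ℕtoℚ (2 ^ (4 ℕ.* suc n)) ∎)
  where
  open ≡-Reasoning
  n = suc k
  N = ℕtoℚ n
  as-lead : ∀ N x → (1 + N) * (1 + 2 * N) * ((1 + 2 * (1 + N)) * x) ≡ (N + 1) * (2 * N + 1) * (2 * N + 3) * x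
  as-lead = solve-∀ ℚ-ring
  as-trail : ∀ N x → 16 * (N + 1) * (2 * N + 1) * (2 * N + 1) * x ≡ 16 * ((1 + N) * (1 + 2 * N)) * ((1 + 2 * N) * x)
  as-trail = solve-∀ ℚ-ring
  reorder : ∀ c p → 16 * c * p ≡ c * (16 * p)
  reorder = solve-∀ ℚ-ring

rhs₀-closed : ∀ n → ℕtoℚ (1 ℕ.+ 2 ℕ.* n) * rhs n 0 ≡ ℕtoℚ (2 ^ (4 ℕ.* n))
rhs₀-closed n = begin
  ℕtoℚ (1 ℕ.+ 2 ℕ.* n) * rhs n 0
    ≡⟨ cong₂ _*_ (ℕtoℚ-homo-+ 1 (2 ℕ.* n))
                 (rhs-indices n 0 (2 ℕ.* n) (1 ℕ.+ 2 ℕ.* n) (sym (ℕ.+-identityʳ _)) (ℕ-Solver.solve (n ∷ []))) ⟩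
  (1 + X) * (P * 1 * fact (2 ℕ.* n) * fact 0 * fact⁻¹ 0 * fact⁻¹ (1 ℕ.+ 2 ℕ.* n))
    ≡⟨ regroup P X (fact (2 ℕ.* n)) (fact 0) (fact⁻¹ 0) (fact⁻¹ (1 ℕ.+ 2 ℕ.* n)) ⟩
  P * (fact 0 * fact⁻¹ 0) * (fact (2 ℕ.* n) * ((1 + X) * fact⁻¹ (1 ℕ.+ 2 ℕ.* n)))
    ≡⟨ cong₂ (λ x y → P * x * (fact (2 ℕ.* n) * y)) (trans (cong₂ _*_ fact-0 fact⁻¹-0) (ℚ.*-identityˡ 1)) (sym (fact⁻¹-suc (2 ℕ.* n))) ⟩
  P * 1 * (fact (2 ℕ.* n) * fact⁻¹ (2 ℕ.* n))
    ≡⟨ cong (P * 1 *_) (fact*fact⁻¹ (2 ℕ.* n)) ⟩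
  P * 1 * 1
    ≡⟨ trans (ℚ.*-identityʳ _) (ℚ.*-identityʳ P) ⟩
  P ∎
  where
  open ≡-Reasoning
  P = ℕtoℚ (2 ^ (4 ℕ.* n))
  X = ℕtoℚ (2 ℕ.* n)
  regroup : ∀ p x f a b i → (1 + x) * (p * 1 * f * a * b * i) ≡ p * (a * b) * (f * ((1 + x) * i))
  regroup = solve-∀ ℚ-ring

-- n ≥ 1 is needed: truncated subtraction reads (4·0 − 0 − 1)! as 0!, so lhs 0 0 = 2 ≠ rhs 0 0.
lhs≡rhs : ∀ n j → 1 ≤ n → j ≤ 2 ℕ.* n → lhs n j ≡ rhs n j
lhs≡rhs zero    j ()
lhs≡rhs (suc k) j _ = lhs≡rhs-from-base (suc k) base j
  where
  base : lhs (suc k) 0 ≡ rhs (suc k) 0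
  base = *-cancelˡ-ℕtoℚ (1 ℕ.+ 2 ℕ.* suc k) (trans (lhs₀-closed k) (sym (rhs₀-closed (suc k))))

-- Identity (ii)

¼ : ℚ
¼ = + 1 / 4

¼^_ : ℕ → ℚ
¼^ zero  = 1
¼^ suc m = ¼^ m * ¼

¼^-+ : ∀ a b → ¼^ (a ℕ.+ b) ≡ ¼^ a * ¼^ b
¼^-+ zero    b = sym (ℚ.*-identityˡ (¼^ b))
¼^-+ (suc a) b = trans (cong (_* ¼) (¼^-+ a b)) (swap (¼^ a) (¼^ b))
  where
  swap : ∀ x y → x * y * ¼ ≡ x * ¼ * y
  swap = solve-∀ ℚ-ring

¼^*4^ : ∀ m → ¼^ m * ℕtoℚ (4 ^ m) ≡ 1
¼^*4^ zero    = refl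
¼^*4^ (suc m) = begin
  ¼^ m * ¼ * ℕtoℚ (4 ℕ.* 4 ^ m)       ≡⟨ cong (¼^ m * ¼ *_) (ℕtoℚ-homo-* 4 (4 ^ m)) ⟩
  ¼^ m * ¼ * (4 * ℕtoℚ (4 ^ m))       ≡⟨ regroup (¼^ m) (ℕtoℚ (4 ^ m)) ⟩
  ¼^ m * ℕtoℚ (4 ^ m)                 ≡⟨ ¼^*4^ m ⟩
  1                                   ∎
  where
  open ≡-Reasoning
  regroup : ∀ x y → x * ¼ * (4 * y) ≡ x * y
  regroup = solve-∀ ℚ-ring

twoPow1m2≡2*¼^ : ∀ ν → twoPow1m2 ν ≡ 2 * ¼^ ν
twoPow1m2≡2*¼^ zero    = refl
twoPow1m2≡2*¼^ (suc ν) = trans (cong (_* ¼) (twoPow1m2≡2*¼^ ν)) (ℚ.*-assoc 2 (¼^ ν) ¼)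

Γhalf-closed : ∀ m → Γhalf (+ m) ≡ fact (2 ℕ.* m) * fact⁻¹ m * ¼^ m
Γhalf-closed zero    = sym (cong₂ (λ x y → x * y * 1) fact-0 fact⁻¹-0)
Γhalf-closed (suc m) = begin
  half (+ m) * Γhalf (+ m)
    ≡⟨ cong₂ _*_ (half-pos m) (Γhalf-closed m) ⟩
  (1 + 2 * M) * ½ * (fact (2 ℕ.* m) * fact⁻¹ m * ¼^ m)
    ≡⟨ cong (λ x → (1 + 2 * M) * ½ * (fact (2 ℕ.* m) * x * ¼^ m)) (fact⁻¹-suc m) ⟩
  (1 + 2 * M) * ½ * (fact (2 ℕ.* m) * ((1 + M) * fact⁻¹ (suc m)) * ¼^ m)
    ≡⟨ regroup M (fact (2 ℕ.* m)) (fact⁻¹ (suc m)) (¼^ m) ⟩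
  rise 2 (2 * M) * fact (2 ℕ.* m) * fact⁻¹ (suc m) * (¼^ m * ¼)
    ≡⟨ cong (λ x → x * fact⁻¹ (suc m) * (¼^ m * ¼)) (sym (fact-shift⟦⟧ 2 (` 2 :* ` m))) ⟩
  fact (2 ℕ.+ 2 ℕ.* m) * fact⁻¹ (suc m) * (¼^ m * ¼)
    ≡⟨ cong (λ n → fact n * fact⁻¹ (suc m) * (¼^ m * ¼)) (sym (ℕ.*-suc 2 m)) ⟩
  fact (2 ℕ.* suc m) * fact⁻¹ (suc m) * ¼^ suc m ∎
  where
  open ≡-Reasoning
  M = ℕtoℚ m
  regroup : ∀ M f i q → (1 + 2 * M) * ½ * (f * ((1 + M) * i) * q) ≡ (2 * M + 1) * (2 * M + 2) * f * i * (q * ¼)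
  regroup = solve-∀ ℚ-ring

Γhalfinv-closed : ∀ m → Γhalfinv (+ m) ≡ fact m * fact⁻¹ (2 ℕ.* m) * ℕtoℚ (4 ^ m)
Γhalfinv-closed zero    = sym (cong₂ (λ x y → x * y * 1) fact-0 fact⁻¹-0)
Γhalfinv-closed (suc m) = begin
  h * Γhalfinv (+ m)
    ≡⟨ cong (h *_) (Γhalfinv-closed m) ⟩
  h * (fact m * fact⁻¹ (2 ℕ.* m) * ℕtoℚ (4 ^ m))
    ≡⟨ cong (λ x → h * (fact m * x * ℕtoℚ (4 ^ m))) (fact⁻¹-shift⟦⟧ 2 (` 2 :* ` m)) ⟩
  h * (fact m * (rise 2 (2 * M) * fact⁻¹ (2 ℕ.+ 2 ℕ.* m)) * ℕtoℚ (4 ^ m))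
    ≡⟨ via-halfInv h (1 + 2 * M) (regroup h M (fact m) (fact⁻¹ (2 ℕ.+ 2 ℕ.* m)) (ℕtoℚ (4 ^ m))) (halfInv-inverse (+ m)) ⟩
  (1 + M) * fact m * fact⁻¹ (2 ℕ.+ 2 ℕ.* m) * (4 * ℕtoℚ (4 ^ m))
    ≡⟨ cong₃ (λ x n y → x * fact⁻¹ n * y) (sym (fact-suc m)) (sym (ℕ.*-suc 2 m)) (sym (ℕtoℚ-homo-* 4 (4 ^ m))) ⟩
  fact (suc m) * fact⁻¹ (2 ℕ.* suc m) * ℕtoℚ (4 ^ suc m) ∎
  where
  open ≡-Reasoning
  h = halfInv (+ m)
  M = ℕtoℚ m
  regroup : ∀ h M f i p → h * (f * ((2 * M + 1) * (2 * M + 2) * i) * p) ≡ (h * (1 + 2 * M)) * ((1 + M) * f * i * (4 * p) * ½)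
  regroup = solve-∀ ℚ-ring

Γhalf*Γhalfinv : ∀ m → Γhalf (+ m) * Γhalfinv (+ m) ≡ 1
Γhalf*Γhalfinv m = begin
  Γhalf (+ m) * Γhalfinv (+ m)
    ≡⟨ cong₂ _*_ (Γhalf-closed m) (Γhalfinv-closed m) ⟩
  fact (2 ℕ.* m) * fact⁻¹ m * ¼^ m * (fact m * fact⁻¹ (2 ℕ.* m) * ℕtoℚ (4 ^ m))
    ≡⟨ regroup (fact (2 ℕ.* m)) (fact⁻¹ m) (¼^ m) (fact m) (fact⁻¹ (2 ℕ.* m)) (ℕtoℚ (4 ^ m)) ⟩
  (fact (2 ℕ.* m) * fact⁻¹ (2 ℕ.* m)) * (fact m * fact⁻¹ m) * (¼^ m * ℕtoℚ (4 ^ m))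
    ≡⟨ cong₃ (λ x y z → x * y * z) (fact*fact⁻¹ (2 ℕ.* m)) (fact*fact⁻¹ m) (¼^*4^ m) ⟩
  1 * 1 * 1 ∎
  where
  open ≡-Reasoning
  regroup : ∀ a b c d e f → a * b * c * (d * e * f) ≡ (a * e) * (d * b) * (c * f)
  regroup = solve-∀ ℚ-ring

Γhalfinv-neg : ∀ m → Γhalfinv -[1+ m ] ≡ - (sgn m * Γhalf (+ suc m))
Γhalfinv-neg zero    = refl
Γhalfinv-neg (suc m) = begin
  half -[1+ suc m ] * Γhalfinv -[1+ m ]                ≡⟨ cong₂ _*_ (half-neg (suc m)) (Γhalfinv-neg m) ⟩
  - half (+ suc m) * - (sgn m * Γhalf (+ suc m))       ≡⟨ negate (half (+ suc m)) (sgn m) (Γhalf (+ suc m)) ⟩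
  - (- sgn m * (half (+ suc m) * Γhalf (+ suc m)))     ∎
  where
  open ≡-Reasoning
  negate : ∀ h s g → - h * - (s * g) ≡ - (- s * (h * g))
  negate = solve-∀ ℚ-ring

-- Reflection formula: 1/Γ(1/2 − μ) = (−1)^μ Γ(1/2 + μ)/π.
Γhalfinv-reflect : ∀ μ → Γhalfinv (+ 0 ℤ.- + μ) ≡ sgn μ * Γhalf (+ μ)
Γhalfinv-reflect zero    = refl
Γhalfinv-reflect (suc m) = trans (Γhalfinv-neg m) (negate (sgn m) (Γhalf (+ suc m)))
  where
  negate : ∀ s g → - (s * g) ≡ - s * g
  negate = solve-∀ ℚ-ring

fallingQ-half : ∀ t b → fallingQ (half (+ b ℤ.+ + t ℤ.- + 1)) t * Γhalf (+ b) ≡ Γhalf (+ (b ℕ.+ t))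
fallingQ-half zero    b = trans (ℚ.*-identityˡ _) (cong (λ n → Γhalf (+ n)) (sym (ℕ.+-identityʳ b)))
fallingQ-half (suc t) b = begin
  fallingQ x t * (x - ℕtoℚ t) * Γhalf (+ b)
    ≡⟨ cong (λ y → fallingQ x t * (y - ℕtoℚ t) * Γhalf (+ b)) x≡ ⟩
  fallingQ x t * (half (+ (b ℕ.+ t)) - ℕtoℚ t) * Γhalf (+ b)
    ≡⟨ cong (λ y → fallingQ x t * y * Γhalf (+ b)) (half-pos-∸ b t) ⟩
  fallingQ x t * half (+ b) * Γhalf (+ b)
    ≡⟨ ℚ.*-assoc (fallingQ x t) (half (+ b)) (Γhalf (+ b)) ⟩
  fallingQ x t * Γhalf (+ suc b)
    ≡⟨ cong (λ n → fallingQ (half (+ n ℤ.- + 1)) t * Γhalf (+ suc b)) (ℕ.+-suc b t) ⟩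
  fallingQ (half (+ suc b ℤ.+ + t ℤ.- + 1)) t * Γhalf (+ suc b)
    ≡⟨ fallingQ-half t (suc b) ⟩
  Γhalf (+ (suc b ℕ.+ t))
    ≡⟨ cong (λ n → Γhalf (+ n)) (sym (ℕ.+-suc b t)) ⟩
  Γhalf (+ (b ℕ.+ suc t)) ∎
  where
  open ≡-Reasoning
  x = half (+ b ℤ.+ + suc t ℤ.- + 1)
  x≡ : x ≡ half (+ (b ℕ.+ t))
  x≡ = cong (λ n → half (+ n ℤ.- + 1)) (ℕ.+-suc b t)

binomQ-half : ∀ t b → binomQ (half (+ b ℤ.+ + t ℤ.- + 1)) t ≡ Γhalf (+ (b ℕ.+ t)) * Γhalfinv (+ b) * fact⁻¹ t
binomQ-half t b = cong₂ _*_ (begin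
  fallingQ x t                                      ≡⟨ cancel (fallingQ x t) (Γhalf (+ b)) (Γhalfinv (+ b)) ⟩
  fallingQ x t * Γhalf (+ b) * Γhalfinv (+ b) + fallingQ x t * (1 - Γhalf (+ b) * Γhalfinv (+ b))
    ≡⟨ cong₂ (λ y z → y * Γhalfinv (+ b) + fallingQ x t * (1 - z)) (fallingQ-half t b) (Γhalf*Γhalfinv b) ⟩
  Γhalf (+ (b ℕ.+ t)) * Γhalfinv (+ b) + fallingQ x t * (1 - 1)
    ≡⟨ vanish (Γhalf (+ (b ℕ.+ t)) * Γhalfinv (+ b)) (fallingQ x t) ⟩
  Γhalf (+ (b ℕ.+ t)) * Γhalfinv (+ b) ∎) (sym (fact⁻¹≡invFactℕ t))
  where
  open ≡-Reasoning
  x = half (+ b ℤ.+ + t ℤ.- + 1)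
  cancel : ∀ f g g′ → f ≡ f * g * g′ + f * (1 - g * g′)
  cancel = solve-∀ ℚ-ring
  vanish : ∀ y f → y + f * (1 - 1) ≡ y
  vanish = solve-∀ ℚ-ring

-- The summand of κcoef (+ 1) (+ 0) ν, i.e. of κ(3/2, 1/2, ν) in units of √π.
κ-summand : ℕ → ℕ → ℚ
κ-summand ν μ = Γhalf (ℤ.+ 1 ℤ.- + 1) * Γhalf (+ 0 ℤ.+ + (2 ℕ.* ν) ℤ.- + μ) * Γhalfinv (ℤ.+ 1 ℤ.- + 1 ℤ.- + μ)
              * binomQ (half (+ 1 ℤ.+ + ν ℤ.- ℤ.+ 1)) (ν ∸ μ) * binomQ (half (+ 0 ℤ.+ + ν ℤ.- ℤ.+ 1)) μ

κcoef-unfold : ∀ ν → κcoef (+ 1) (+ 0) ν ≡ invFact (+ 1 ℤ.+ + 0 ℤ.+ + (2 ℕ.* ν) ℤ.- + 1) * 2 * sumTo ν (κ-summand ν)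
κcoef-unfold ν = refl

κ-scale : ℕ → ℚ
κ-scale ν = 2 * ¼^ ν * Γhalf (+ suc ν) * Γhalf (+ ν)

+[a+b]-+b : ∀ a b → + (a ℕ.+ b) ℤ.- + b ≡ + a
+[a+b]-+b a b = cancel (+ a) (+ b)
  where
  cancel : ∀ x y → x ℤ.+ y ℤ.- y ≡ x
  cancel = solve-∀ ℤ-Solver.ring

Γhalf*Γhalfinv-suc : ∀ μ → Γhalf (+ μ) * Γhalfinv (+ suc μ) ≡ halfInv (+ μ)
Γhalf*Γhalfinv-suc μ = begin
  Γhalf (+ μ) * (halfInv (+ μ) * Γhalfinv (+ μ))    ≡⟨ swap (Γhalf (+ μ)) (halfInv (+ μ)) (Γhalfinv (+ μ)) ⟩
  halfInv (+ μ) * (Γhalf (+ μ) * Γhalfinv (+ μ))    ≡⟨ cong (halfInv (+ μ) *_) (Γhalf*Γhalfinv μ) ⟩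
  halfInv (+ μ) * 1                                 ≡⟨ ℚ.*-identityʳ _ ⟩
  halfInv (+ μ)                                     ∎
  where
  open ≡-Reasoning
  swap : ∀ g h g′ → g * (h * g′) ≡ h * (g * g′)
  swap = solve-∀ ℚ-ring

Γhalfinv*fact⁻¹ : ∀ t → Γhalfinv (+ t) * fact⁻¹ t ≡ fact⁻¹ (2 ℕ.* t) * ℕtoℚ (4 ^ t)
Γhalfinv*fact⁻¹ t = begin
  Γhalfinv (+ t) * fact⁻¹ t                                       ≡⟨ cong (_* fact⁻¹ t) (Γhalfinv-closed t) ⟩
  fact t * fact⁻¹ (2 ℕ.* t) * ℕtoℚ (4 ^ t) * fact⁻¹ t             ≡⟨ regroup (fact t) (fact⁻¹ (2 ℕ.* t)) (ℕtoℚ (4 ^ t)) (fact⁻¹ t) ⟩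
  (fact t * fact⁻¹ t) * (fact⁻¹ (2 ℕ.* t) * ℕtoℚ (4 ^ t))        ≡⟨ cong (_* (fact⁻¹ (2 ℕ.* t) * ℕtoℚ (4 ^ t))) (fact*fact⁻¹ t) ⟩
  1 * (fact⁻¹ (2 ℕ.* t) * ℕtoℚ (4 ^ t))                           ≡⟨ ℚ.*-identityˡ _ ⟩
  fact⁻¹ (2 ℕ.* t) * ℕtoℚ (4 ^ t)                                 ∎
  where
  open ≡-Reasoning
  regroup : ∀ f i p j → f * i * p * j ≡ (f * j) * (i * p)
  regroup = solve-∀ ℚ-ring

double-via-complement : ∀ ν′ μ t → μ ℕ.+ t ≡ suc ν′ → 2 ℕ.* suc ν′ ≡ suc (ν′ ℕ.+ t) ℕ.+ μ
double-via-complement ν′ μ t μ+t≡ν = begin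
  2 ℕ.* suc ν′                 ≡⟨ double ν′ ⟩
  suc ν′ ℕ.+ suc ν′            ≡⟨ cong (suc ν′ ℕ.+_) (trans (ℕ.+-comm t μ) μ+t≡ν) ⟨
  suc ν′ ℕ.+ (t ℕ.+ μ)         ≡⟨ ℕ.+-assoc (suc ν′) t μ ⟨
  suc (ν′ ℕ.+ t) ℕ.+ μ         ∎
  where
  open ≡-Reasoning
  double : ∀ n → 2 ℕ.* suc n ≡ suc n ℕ.+ suc n
  double = ℕ-Solver.solve-∀

coeff-via-complement : ∀ ν′ μ t → μ ℕ.+ t ≡ suc ν′ → let r = ν′ ℕ.+ t in
  coeff (suc ν′) μ ≡ sgn μ * fact (1 ℕ.+ 2 ℕ.* r) * fact⁻¹ (2 ℕ.* t) * fact⁻¹ r * fact⁻¹ μ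
coeff-via-complement ν′ μ t μ+t≡ν = coeff-indices (suc ν′) μ (1 ℕ.+ 2 ℕ.* r) (2 ℕ.* t) r
  (trans (quadruple (suc ν′)) (trans (cong (2 ℕ.*_) 2ν≡) (index₁ r μ)))
  (trans (cong (2 ℕ.*_) (sym (trans (ℕ.+-comm t μ) μ+t≡ν))) (ℕ.*-distribˡ-+ 2 t μ))
  (trans 2ν≡ (index₃ r μ))
  where
  r = ν′ ℕ.+ t
  2ν≡ = double-via-complement ν′ μ t μ+t≡ν
  quadruple : ∀ n → 4 ℕ.* n ≡ 2 ℕ.* (2 ℕ.* n)
  quadruple = ℕ-Solver.solve-∀
  index₁ : ∀ r μ → 2 ℕ.* (suc r ℕ.+ μ) ≡ 1 ℕ.+ 2 ℕ.* r ℕ.+ 1 ℕ.+ 2 ℕ.* μ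
  index₁ = ℕ-Solver.solve-∀
  index₃ : ∀ r μ → suc r ℕ.+ μ ≡ r ℕ.+ 1 ℕ.+ μ
  index₃ = ℕ-Solver.solve-∀

κ-summand-Γ : ∀ ν′ μ → μ ≤ suc ν′ → let ν = suc ν′; t = ν ∸ μ in
  κ-summand ν μ ≡ Γhalf (+ 0) * Γhalf (+ suc (ν′ ℕ.+ t)) * (sgn μ * Γhalf (+ μ))
                * (Γhalf (+ suc ν) * Γhalfinv (+ suc μ) * fact⁻¹ t) * (Γhalf (+ ν) * Γhalfinv (+ t) * fact⁻¹ μ)
κ-summand-Γ ν′ μ μ≤ν = cong₄ (λ x y z w → Γhalf (+ 0) * x * y * z * w)
  (cong Γhalf (trans (cong (λ n → + n ℤ.- + μ) (double-via-complement ν′ μ t μ+t≡ν)) (+[a+b]-+b (suc (ν′ ℕ.+ t)) μ)))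
  (Γhalfinv-reflect μ)
  (trans (cong (λ n → binomQ (half (+ n ℤ.- + 1)) t) (cong suc (sym μ+t≡ν)))
         (trans (binomQ-half t (suc μ)) (cong (λ n → Γhalf (+ suc n) * Γhalfinv (+ suc μ) * fact⁻¹ t) μ+t≡ν)))
  (trans (cong (λ n → binomQ (half (+ n ℤ.- + 1)) μ) (sym t+μ≡ν))
         (trans (binomQ-half μ t) (cong (λ n → Γhalf (+ n) * Γhalfinv (+ t) * fact⁻¹ μ) t+μ≡ν)))
  where
  t = suc ν′ ∸ μ
  μ+t≡ν : μ ℕ.+ t ≡ suc ν′
  μ+t≡ν = ℕ.m+[n∸m]≡n μ≤ν
  t+μ≡ν : t ℕ.+ μ ≡ suc ν′
  t+μ≡ν = trans (ℕ.+-comm t μ) μ+t≡ν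

Γhalf-suc-closed : ∀ a b → let r = a ℕ.+ b in
  Γhalf (+ suc r) ≡ rise 1 (1 + 2 * ℕtoℚ r) * fact (1 ℕ.+ 2 ℕ.* r) * fact⁻¹ (suc r) * (¼^ suc a * ¼^ b)
Γhalf-suc-closed a b = begin
  Γhalf (+ suc r)                                            ≡⟨ Γhalf-closed (suc r) ⟩
  fact (2 ℕ.* suc r) * fact⁻¹ (suc r) * ¼^ suc r             ≡⟨ cong₂ (λ n q → fact n * fact⁻¹ (suc r) * q) (ℕ.*-suc 2 r) (¼^-+ (suc a) b) ⟩
  fact (2 ℕ.+ 2 ℕ.* r) * fact⁻¹ (suc r) * (¼^ suc a * ¼^ b)  ≡⟨ cong (λ f → f * fact⁻¹ (suc r) * (¼^ suc a * ¼^ b)) (fact-shift⟦⟧ 1 (` 1 :+ ` 2 :* ` r)) ⟩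
  rise 1 (1 + 2 * ℕtoℚ r) * fact (1 ℕ.+ 2 ℕ.* r) * fact⁻¹ (suc r) * (¼^ suc a * ¼^ b) ∎
  where
  open ≡-Reasoning
  r = a ℕ.+ b

κ-summand≡κ-scale*summand : ∀ ν′ μ → μ ≤ suc ν′ → κ-summand (suc ν′) μ ≡ κ-scale (suc ν′) * summand (suc ν′) 0 μ
κ-summand≡κ-scale*summand ν′ μ μ≤ν = begin
  κ-summand ν μ
    ≡⟨ κ-summand-Γ ν′ μ μ≤ν ⟩
  Γhalf (+ 0) * Γhalf (+ suc r) * (sgn μ * Γhalf (+ μ)) * (G₁ * Γhalfinv (+ suc μ) * fact⁻¹ t) * (G₀ * Γhalfinv (+ t) * fact⁻¹ μ)
    ≡⟨ regroup (Γhalf (+ suc r)) (sgn μ) (Γhalf (+ μ)) G₁ (Γhalfinv (+ suc μ)) (fact⁻¹ t) G₀ (Γhalfinv (+ t)) (fact⁻¹ μ) ⟩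
  Γhalf (+ suc r) * sgn μ * G₁ * G₀ * (Γhalf (+ μ) * Γhalfinv (+ suc μ)) * (Γhalfinv (+ t) * fact⁻¹ t) * fact⁻¹ μ
    ≡⟨ cong₃ (λ a b c → a * sgn μ * G₁ * G₀ * b * c * fact⁻¹ μ) (Γhalf-suc-closed ν′ t) (Γhalf*Γhalfinv-suc μ) (Γhalfinv*fact⁻¹ t) ⟩
  rise 1 (1 + 2 * R) * F * fact⁻¹ (suc r) * (¼^ ν * ¼^ t) * sgn μ * G₁ * G₀ * halfInv (+ μ)
    * (fact⁻¹ (2 ℕ.* t) * ℕtoℚ (4 ^ t)) * fact⁻¹ μ
    ≡⟨ collect (sgn μ) F (fact⁻¹ (suc r)) (¼^ ν) (¼^ t) (ℕtoℚ (4 ^ t)) G₁ G₀ (halfInv (+ μ)) (fact⁻¹ (2 ℕ.* t)) (fact⁻¹ μ) R ⟩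
  (¼^ t * ℕtoℚ (4 ^ t)) * (κ-scale ν * (sgn μ * F * fact⁻¹ (2 ℕ.* t) * ((1 + R) * fact⁻¹ (suc r)) * fact⁻¹ μ * halfInv (+ μ)))
    ≡⟨ cong₂ (λ a b → a * (κ-scale ν * (sgn μ * F * fact⁻¹ (2 ℕ.* t) * b * fact⁻¹ μ * halfInv (+ μ)))) (¼^*4^ t) (sym (fact⁻¹-suc r)) ⟩
  1 * (κ-scale ν * (sgn μ * F * fact⁻¹ (2 ℕ.* t) * fact⁻¹ r * fact⁻¹ μ * halfInv (+ μ)))
    ≡⟨ ℚ.*-identityˡ _ ⟩
  κ-scale ν * (sgn μ * F * fact⁻¹ (2 ℕ.* t) * fact⁻¹ r * fact⁻¹ μ * halfInv (+ μ))
    ≡⟨ cong₂ (λ c h → κ-scale ν * (c * h)) (sym (coeff-via-complement ν′ μ t (ℕ.m+[n∸m]≡n μ≤ν)))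
                                          (cong halfInv (sym (ℤ.+-identityʳ (+ μ)))) ⟩
  κ-scale ν * summand ν 0 μ ∎
  where
  open ≡-Reasoning
  ν = suc ν′
  t = ν ∸ μ
  r = ν′ ℕ.+ t
  R = ℕtoℚ r
  F = fact (1 ℕ.+ 2 ℕ.* r)
  G₁ = Γhalf (+ suc ν)
  G₀ = Γhalf (+ ν)
  regroup : ∀ g s g′ a b c d e f → Γhalf (+ 0) * g * (s * g′) * (a * b * c) * (d * e * f) ≡ g * s * a * d * (g′ * b) * (e * c) * f
  regroup = solve-∀ ℚ-ring
  collect : ∀ s F I Q q p G₁ G₀ h J Iμ R →
    (1 + 2 * R + 1) * F * I * (Q * q) * s * G₁ * G₀ * h * (J * p) * Iμ
    ≡ (q * p) * (2 * Q * G₁ * G₀ * (s * F * J * ((1 + R) * I) * Iμ * h))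
  collect = solve-∀ ℚ-ring

central-binomial : ∀ n → ((2 ℕ.* n) C n) ℕ.* (n ! ℕ.* n !) ≡ (2 ℕ.* n) !
central-binomial n = begin
  ((2 ℕ.* n) C n) ℕ.* (n ! ℕ.* n !)                       ≡⟨ cong (λ m → ((2 ℕ.* n) C n) ℕ.* (n ! ℕ.* m !)) (sym 2n∸n≡n) ⟩
  ((2 ℕ.* n) C n) ℕ.* (n ! ℕ.* (2 ℕ.* n ∸ n) !)           ≡⟨ cong (ℕ._* (n ! ℕ.* (2 ℕ.* n ∸ n) !)) (nCk≡n!/k![n-k]! n≤2n) ⟩
  ((2 ℕ.* n) ! ℕ./ (n ! ℕ.* (2 ℕ.* n ∸ n) !)) ℕ.* (n ! ℕ.* (2 ℕ.* n ∸ n) !)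
                                                          ≡⟨ m/n*n≡m (k![n∸k]!∣n! n≤2n) ⟩
  (2 ℕ.* n) !                                             ∎
  where
  open ≡-Reasoning
  instance _ = ℕ.m*n≢0 (n !) ((2 ℕ.* n ∸ n) !) {{n ℕ.!≢0}} {{(2 ℕ.* n ∸ n) ℕ.!≢0}}
  n≤2n : n ≤ 2 ℕ.* n
  n≤2n = ℕ.m≤n*m n 2
  2n∸n≡n : 2 ℕ.* n ∸ n ≡ n
  2n∸n≡n = m≡n+o⇒m∸o≡n n n (ℕ-Solver.solve (n ∷ []))

ℕtoℚ-central-binomial : ∀ n → ℕtoℚ ((2 ℕ.* n) C n) ≡ fact (2 ℕ.* n) * fact⁻¹ n * fact⁻¹ n
ℕtoℚ-central-binomial n = begin
  binom                                                  ≡⟨ units binom ⟨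
  binom * 1 * 1                                          ≡⟨ cong (λ u → binom * u * u) (fact*fact⁻¹ n) ⟨
  binom * (fact n * fact⁻¹ n) * (fact n * fact⁻¹ n)      ≡⟨ regroup binom (fact n) (fact⁻¹ n) ⟩
  binom * (fact n * fact n) * fact⁻¹ n * fact⁻¹ n        ≡⟨ cong (λ x → x * fact⁻¹ n * fact⁻¹ n) binom*n!*n! ⟩
  fact (2 ℕ.* n) * fact⁻¹ n * fact⁻¹ n                   ∎
  where
  open ≡-Reasoning
  binom = ℕtoℚ ((2 ℕ.* n) C n)
  binom*n!*n! : binom * (fact n * fact n) ≡ fact (2 ℕ.* n)
  binom*n!*n! = begin
    binom * (fact n * fact n)                    ≡⟨ cong₂ (λ x y → binom * (x * y)) (fact≡factQ n) (fact≡factQ n) ⟩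
    binom * (ℕtoℚ (n !) * ℕtoℚ (n !))            ≡⟨ cong (binom *_) (sym (ℕtoℚ-homo-* (n !) (n !))) ⟩
    binom * ℕtoℚ (n ! ℕ.* n !)                   ≡⟨ sym (ℕtoℚ-homo-* ((2 ℕ.* n) C n) (n ! ℕ.* n !)) ⟩
    ℕtoℚ (((2 ℕ.* n) C n) ℕ.* (n ! ℕ.* n !))     ≡⟨ cong ℕtoℚ (central-binomial n) ⟩
    ℕtoℚ ((2 ℕ.* n) !)                           ≡⟨ sym (fact≡factQ (2 ℕ.* n)) ⟩
    fact (2 ℕ.* n)                               ∎
  units : ∀ b → b * 1 * 1 ≡ b
  units = solve-∀ ℚ-ring
  regroup : ∀ b f i → b * (f * i) * (f * i) ≡ b * (f * f) * i * i
  regroup = solve-∀ ℚ-ring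

ℕtoℚ-2^4n : ∀ n → ℕtoℚ (2 ^ (4 ℕ.* n)) ≡ ℕtoℚ (4 ^ n) * ℕtoℚ (4 ^ n)
ℕtoℚ-2^4n n = trans (cong ℕtoℚ 2^4n≡4^n*4^n) (ℕtoℚ-homo-* (4 ^ n) (4 ^ n))
  where
  2^4n≡4^n*4^n : 2 ^ (4 ℕ.* n) ≡ 4 ^ n ℕ.* 4 ^ n
  2^4n≡4^n*4^n = begin
    2 ^ (4 ℕ.* n)                  ≡⟨ cong (2 ^_) (split n) ⟩
    2 ^ (2 ℕ.* n ℕ.+ 2 ℕ.* n)      ≡⟨ ℕ.^-distribˡ-+-* 2 (2 ℕ.* n) (2 ℕ.* n) ⟩
    2 ^ (2 ℕ.* n) ℕ.* 2 ^ (2 ℕ.* n) ≡⟨ cong₂ ℕ._*_ (ℕ.^-*-assoc 2 2 n) (ℕ.^-*-assoc 2 2 n) ⟨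
    4 ^ n ℕ.* 4 ^ n                ∎
    where
    open ≡-Reasoning
    split : ∀ n → 4 ℕ.* n ≡ 2 ℕ.* n ℕ.+ 2 ℕ.* n
    split = ℕ-Solver.solve-∀

κcoef-closed : ∀ ν → κcoef (+ 1) (+ 0) ν ≡ twoPow1m2 ν * ℕtoℚ ((2 ℕ.* ν) C ν)
κcoef-closed zero     = refl
κcoef-closed (suc ν′) = *-cancelˡ-ℕtoℚ (1 ℕ.+ 2 ℕ.* ν) (begin
  ℕtoℚ (1 ℕ.+ 2 ℕ.* ν) * (invFact (+ 1 ℤ.+ + 0 ℤ.+ + (2 ℕ.* ν) ℤ.- + 1) * 2 * sumTo ν (κ-summand ν))
    ≡⟨ cong₂ (λ x y → ℕtoℚ (1 ℕ.+ 2 ℕ.* ν) * (x * 2 * y)) (invFact≡fact⁻¹ℤ (+ 1 ℤ.+ + 0 ℤ.+ + (2 ℕ.* ν) ℤ.- + 1)) Σκ-summand ⟩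
  ℕtoℚ (1 ℕ.+ 2 ℕ.* ν) * (fact⁻¹ (2 ℕ.* ν) * 2 * (κ-scale ν * lhs ν 0))
    ≡⟨ regroup (ℕtoℚ (1 ℕ.+ 2 ℕ.* ν)) (fact⁻¹ (2 ℕ.* ν)) (κ-scale ν) (lhs ν 0) ⟩
  fact⁻¹ (2 ℕ.* ν) * 2 * κ-scale ν * (ℕtoℚ (1 ℕ.+ 2 ℕ.* ν) * lhs ν 0)
    ≡⟨ cong (fact⁻¹ (2 ℕ.* ν) * 2 * κ-scale ν *_) (trans (lhs₀-closed ν′) (ℕtoℚ-2^4n ν)) ⟩
  fact⁻¹ (2 ℕ.* ν) * 2 * (2 * ¼^ ν * Γhalf (+ suc ν) * Γhalf (+ ν)) * (p * p)
    ≡⟨ cong₂ (λ x y → fact⁻¹ (2 ℕ.* ν) * 2 * (2 * ¼^ ν * x * y) * (p * p)) Γ[1+ν] Γ[ν] ⟩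
  fact⁻¹ (2 ℕ.* ν) * 2 * (2 * ¼^ ν * (rise 2 (2 * N) * fact (2 ℕ.* ν) * fact⁻¹ (suc ν) * (¼^ ν * ¼))
    * (fact (2 ℕ.* ν) * ((1 + N) * fact⁻¹ (suc ν)) * ¼^ ν)) * (p * p)
    ≡⟨ collect (fact⁻¹ (2 ℕ.* ν)) (fact (2 ℕ.* ν)) (¼^ ν) p (fact⁻¹ (suc ν)) N ⟩
  (fact (2 ℕ.* ν) * fact⁻¹ (2 ℕ.* ν)) * (¼^ ν * p) * (¼^ ν * p)
    * ((1 + 2 * N) * (2 * ¼^ ν * (fact (2 ℕ.* ν) * ((1 + N) * fact⁻¹ (suc ν)) * ((1 + N) * fact⁻¹ (suc ν)))))
    ≡⟨ cong₃ (λ x y z → x * y * y * ((1 + 2 * N) * z)) (fact*fact⁻¹ (2 ℕ.* ν)) (¼^*4^ ν) (cong₂ _*_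
         (sym (twoPow1m2≡2*¼^ ν)) (sym (trans (ℕtoℚ-central-binomial ν) (cong (λ x → fact (2 ℕ.* ν) * x * x) (fact⁻¹-suc ν))))) ⟩
  1 * 1 * 1 * ((1 + 2 * N) * (twoPow1m2 ν * ℕtoℚ ((2 ℕ.* ν) C ν)))
    ≡⟨ trans (ℚ.*-identityˡ _) (cong (_* (twoPow1m2 ν * ℕtoℚ ((2 ℕ.* ν) C ν))) (sym (ℕtoℚ-⟦⟧ (` 1 :+ ` 2 :* ` ν)))) ⟩
  ℕtoℚ (1 ℕ.+ 2 ℕ.* ν) * (twoPow1m2 ν * ℕtoℚ ((2 ℕ.* ν) C ν)) ∎)
  where
  open ≡-Reasoning
  ν = suc ν′
  N = ℕtoℚ ν
  p = ℕtoℚ (4 ^ ν)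
  Σκ-summand : sumTo ν (κ-summand ν) ≡ κ-scale ν * lhs ν 0
  Σκ-summand = trans (sumTo-cong ν (κ-summand≡κ-scale*summand ν′)) (sym (sumTo-scale ν (summand ν 0) (κ-scale ν)))
  Γ[ν] : Γhalf (+ ν) ≡ fact (2 ℕ.* ν) * ((1 + N) * fact⁻¹ (suc ν)) * ¼^ ν
  Γ[ν] = trans (Γhalf-closed ν) (cong (λ x → fact (2 ℕ.* ν) * x * ¼^ ν) (fact⁻¹-suc ν))
  Γ[1+ν] : Γhalf (+ suc ν) ≡ rise 2 (2 * N) * fact (2 ℕ.* ν) * fact⁻¹ (suc ν) * (¼^ ν * ¼)
  Γ[1+ν] = trans (Γhalf-closed (suc ν))
    (cong (λ f → f * fact⁻¹ (suc ν) * (¼^ ν * ¼)) (trans (cong fact (ℕ.*-suc 2 ν)) (fact-shift⟦⟧ 2 (` 2 :* ` ν))))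
  regroup : ∀ a i k l → a * (i * 2 * (k * l)) ≡ i * 2 * k * (a * l)
  regroup = solve-∀ ℚ-ring
  collect : ∀ I F Q p J N →
    I * 2 * (2 * Q * ((2 * N + 1) * (2 * N + 2) * F * J * (Q * ¼)) * (F * ((1 + N) * J) * Q)) * (p * p)
    ≡ (F * I) * (Q * p) * (Q * p) * ((1 + 2 * N) * (2 * Q * (F * ((1 + N) * J) * ((1 + N) * J))))
  collect = solve-∀ ℚ-ring

lhs-unfold : ∀ ν j → lhs ν j ≡ sumTo ν (λ μ → sgn μ * halfInv ((+ μ) ℤ.- (+ j))
  * factQ (4 ℕ.* ν ∸ 2 ℕ.* μ ∸ 1) * invFactℕ (2 ℕ.* (ν ∸ μ)) * invFactℕ (2 ℕ.* ν ∸ μ ∸ 1) * invFactℕ μ)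
lhs-unfold ν j = sumTo-cong ν λ μ _ →
  trans (cong₄ (λ a b c d → sgn μ * a * b * c * d * halfInv (+ μ ℤ.- + j))
               (fact≡factQ _) (fact⁻¹≡invFactℕ _) (fact⁻¹≡invFactℕ _) (fact⁻¹≡invFactℕ μ))
        (reorder (sgn μ) _ _ _ _ (halfInv (+ μ ℤ.- + j)))
  where
  reorder : ∀ s a b c d h → s * a * b * c * d * h ≡ s * h * a * b * c * d
  reorder = solve-∀ ℚ-ring

rhs-unfold : ∀ ν j → rhs ν j ≡ ℕtoℚ (2 ^ (4 ℕ.* ν)) * sgn j * factQ (2 ℕ.* ν ∸ j) * factQ j
  * invFactℕ (2 ℕ.* j) * invFact ((+ (2 ℕ.* ν)) ℤ.- (+ (2 ℕ.* j)) ℤ.+ (+ 1))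
rhs-unfold ν j = cong₄ (λ a b c d → ℕtoℚ (2 ^ (4 ℕ.* ν)) * sgn j * a * b * c * d)
  (fact≡factQ _) (fact≡factQ j) (fact⁻¹≡invFactℕ _) (sym (invFact≡fact⁻¹ℤ (+ (2 ℕ.* ν) ℤ.- + (2 ℕ.* j) ℤ.+ + 1)))

lemma5p2 : ((ν j : ℕ) → 1 ≤ ν → j ≤ 2 ℕ.* ν →
    sumTo ν (λ μ → sgn μ * halfInv ((+ μ) ℤ.- (+ j))
    * factQ (4 ℕ.* ν ∸ 2 ℕ.* μ ∸ 1)
    * invFactℕ (2 ℕ.* (ν ∸ μ)) * invFactℕ (2 ℕ.* ν ∸ μ ∸ 1) * invFactℕ μ)
    ≡ ℕtoℚ (2 ^ (4 ℕ.* ν)) * sgn j * factQ (2 ℕ.* ν ∸ j) * factQ j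
    * invFactℕ (2 ℕ.* j) * invFact ((+ (2 ℕ.* ν)) ℤ.- (+ (2 ℕ.* j)) ℤ.+ (+ 1)))
    × ((ν : ℕ) →
    κcoef (+ 1) (+ 0) ν ≡ twoPow1m2 ν * ℕtoℚ ((2 ℕ.* ν) C ν))
lemma5p2 = (λ ν j 1≤ν j≤2ν → trans (sym (lhs-unfold ν j)) (trans (lhs≡rhs ν j 1≤ν j≤2ν) (rhs-unfold ν j)))
         , κcoef-closed
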